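{- For $n\geqslant1$ let $\widehat{R}(n,k)$ be the number of up signed permutations in $B_n$ with $k$ alternating runs and $\widehat{R}_n(x)=\sum_{k=1}^n\widehat{R}(n,k)x^k$. Then for every $n\geqslant1$, $$\widehat{R}_{2n}(x)=x(1+x)^{n-1}\sum_{j=0}^{n}2^j(2j)!\,V(n,j)\,x^j(1-x)^{n-j},$$ $$\widehat{R}_{2n+1}(x)=x(1+x)^{n}\sum_{j=0}^{n}2^j(2j+1)!\,V(n,j)\,x^j(1-x)^{n-j}.$$
   Context: $B_n$ is the hyperoctahedral group: signed permutations $\pi$ of $\pm[n]=\{\pm1,\ldots,\pm n\}$ with $\pi(-i)=-\pi(i)$. A signed permutation is identified with the word $\pi(0)\pi(1)\cdots\pi(n)$ where $\pi(0)=0$, using the order $\cdots<-2<-1<0<1<2<\cdots$. A run is a maximal interval of consecutive entries of this word on which it is monotonic; the number of alternating runs is the number of such runs (i.e. one plus the number of $i\in\{1,\ldots,n-1\}$ at which the word changes direction). An up signed permutation is one with $\pi(1)>0$. The numbers $V(n,k)$ ($n,k\geqslant0$) are defined by $V(0,0)=1$, $V(0,k)=0$ for $k\neq0$, and $V(n,k)=V(n-1,k-1)+(2k+1)^2V(n-1,k)$. -}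

module Defs where

open import Data.Bool using (Bool; true; false; _∧_; _xor_; if_then_else_)
open import Data.Nat as ℕ using (ℕ; zero; suc)
open import Data.Integer as ℤ using (ℤ; +_; -_; ∣_∣)
open import Data.Integer.Properties using (_<?_)
open import Data.List using (List; []; _∷_; map; concatMap; filter; length; upTo; downFrom; _++_)
open import Data.List.Relation.Unary.Unique.Propositional using (Unique)
import Data.List.Relation.Unary.AllPairs as AllPairs
open import Relation.Nullary using (¬?)
open import Relation.Nullary.Decidable using (⌊_⌋)
open import Relation.Unary using (Decidable)
import Data.Nat.Properties as ℕP
open import Relation.Binary.PropositionalEquality using (_≡_)

-- Signed permutations of ±[n], represented by the word π(1) … π(n).
-- A word w ∈ (±[n])^n is a signed permutation iff the absolute values
-- of its entries are pairwise distinct (then they form a permutation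
-- of [n], and π(-i) = -π(i) determines π on negatives).

pmSet : ℕ → List ℤ
pmSet n = map (λ i → - (+ suc i)) (upTo n) ++ map (λ i → + suc i) (upTo n)

words : ℕ → ℕ → List (List ℤ)
words n zero    = [] ∷ []
words n (suc m) = concatMap (λ a → map (a ∷_) (words n m)) (pmSet n)

IsSignedPerm : List ℤ → Set
IsSignedPerm w = Unique (map ∣_∣ w)

isSignedPerm? : Decidable IsSignedPerm
isSignedPerm? w = AllPairs.allPairs? (λ x y → ¬? (x ℕP.≟ y)) (map ∣_∣ w)

B : ℕ → List (List ℤ)
B n = filter isSignedPerm? (words n n)

isUp : List ℤ → Bool
isUp []      = false
isUp (a ∷ _) = ⌊ + 0 <? a ⌋

turns : List ℤ → ℕ
turns (a ∷ b ∷ c ∷ rest) =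
  (if ⌊ a <? b ⌋ xor ⌊ b <? c ⌋ then 1 else 0) ℕ.+ turns (b ∷ c ∷ rest)
turns _ = 0

altRuns : List ℤ → ℕ
altRuns w = suc (turns (+ 0 ∷ w))

Rhat : ℕ → ℕ → ℕ
Rhat n k = count (λ w → isUp w ∧ ⌊ altRuns w ℕP.≟ k ⌋) (B n)
  where
  count : (List ℤ → Bool) → List (List ℤ) → ℕ
  count p []       = 0
  count p (w ∷ ws) = (if p w then 1 else 0) ℕ.+ count p ws

V : ℕ → ℕ → ℕ
V zero    zero    = 1
V zero    (suc k) = 0
V (suc n) zero    = V n 0
V (suc n) (suc k) = V n k ℕ.+ (2 ℕ.* suc k ℕ.+ 1) ℕ.^ 2 ℕ.* V n (suc k)

-- Polynomials over ℤ, as coefficient lists (constant term first).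

Poly : Set
Poly = List ℤ

_⊕_ : Poly → Poly → Poly
[]       ⊕ q        = q
p        ⊕ []       = p
(a ∷ p)  ⊕ (b ∷ q)  = (a ℤ.+ b) ∷ (p ⊕ q)

scale : ℤ → Poly → Poly
scale c = map (c ℤ.*_)

_⊗_ : Poly → Poly → Poly
[]      ⊗ q = []
(a ∷ p) ⊗ q = scale a q ⊕ (+ 0 ∷ (p ⊗ q))

const : ℤ → Poly
const c = c ∷ []

X : Poly
X = + 0 ∷ + 1 ∷ []

_^^_ : Poly → ℕ → Poly
p ^^ zero  = const (+ 1)
p ^^ suc n = p ⊗ (p ^^ n)

coeff : Poly → ℕ → ℤ
coeff []      _       = + 0
coeff (a ∷ p) zero    = a
coeff (a ∷ p) (suc k) = coeff p k

_≐_ : Poly → Poly → Set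
p ≐ q = ∀ k → coeff p k ≡ coeff q k

sumP : ℕ → ℕ → (ℕ → Poly) → Poly
sumP lo zero    f = if ⌊ lo ℕP.≟ 0 ⌋ then f 0 else []
sumP lo (suc h) f = sumP lo h f ⊕ (if ⌊ lo ℕP.≤? suc h ⌋ then f (suc h) else [])

RhatPoly : ℕ → Poly
RhatPoly n = sumP 1 n (λ k → const (+ Rhat n k) ⊗ (X ^^ k))

1+x 1-x : Poly
1+x = + 1 ∷ + 1 ∷ []
1-x = + 1 ∷ ℤ.-[1+ 0 ] ∷ []

rhsPoly : ℕ → ℕ → (ℕ → ℕ) → Poly
rhsPoly n e c = X ⊗ ((1+x ^^ e) ⊗
  sumP 0 n (λ j → const (+ (c j ℕ.* V n j)) ⊗ ((X ^^ j) ⊗ (1-x ^^ (n ℕ.∸ j)))))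

-- Every element of B (n+1) arises exactly once from an element of B n by inserting ±(n+1)
-- at one of n+1 positions, and negating all entries exchanges up and down signed
-- permutations while preserving the number of alternating runs. Tracking how a new largest
-- entry changes the word of ascents and descents yields the recurrence
--   R̂_{n+1}(x) = (2n x² + 3x − 1) R̂_n(x) + 2x(1 − x²) R̂_n′(x)   (n ≥ 1).
-- The right-hand sides satisfy the same recurrence, alternating between the even and the odd
-- formula: the operator acts on each term x (1+x)^e x^j (1−x)^k through its logarithmic
-- derivative, and the coefficients match by V(n+1,j) = V(n,j−1) + (2j+1)² V(n,j).
-- Both sides agree for R̂_1.

module Submission where

open import Defs
open import Data.Nat using (ℕ; suc; _*_; _^_; _!; _≥_; _∸_)
open import Data.Product using (_×_)

open import Algebra.Bundles using (CommutativeRing; RawRing)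
open import Algebra.Structures using (IsCommutativeRing)
import Algebra.Solver.Ring as RingSolver
open import Algebra.Solver.Ring.AlmostCommutativeRing
  using (AlmostCommutativeRing; fromCommutativeRing; _-Raw-AlmostCommutative⟶_)
import Data.Bool.Properties as BoolP
open import Data.Bool using (Bool; true; false; if_then_else_; _xor_; not; _∧_)
open import Data.Empty using (⊥; ⊥-elim)
open import Data.Integer using (ℤ; +_; -[1+_]; ∣_∣; +<+; -<+)
  renaming (_+_ to _+ᶻ_; _*_ to _*ᶻ_; -_ to -ᶻ_; _<_ to _<ᶻ_)
import Data.Integer.Properties as ℤP
open import Data.Integer.Properties using (_<?_)
open import Data.List
  using (List; []; _∷_; map; _++_; length; upTo; concatMap; cartesianProduct; cartesianProductWith)
import Data.List.Properties as LP
open import Data.List.Membership.Propositional using (_∈_; _∉_)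
open import Data.List.Membership.Propositional.Properties
open import Data.List.Membership.Propositional.Properties.WithK using (unique∧set⇒bag)
open import Data.List.Relation.Binary.BagAndSetEquality using (∼bag⇒↭)
open import Data.List.Relation.Binary.Permutation.Propositional as ↭ using (_↭_)
open import Data.List.Relation.Unary.All as All using (All; []; _∷_)
import Data.List.Relation.Unary.All.Properties as AllP
import Data.List.Relation.Unary.AllPairs as AllPairs
open import Data.List.Relation.Unary.Any using (here; there)
open import Data.List.Relation.Unary.Unique.Propositional using (Unique)
import Data.List.Relation.Unary.Unique.Propositional.Properties as UP
open import Data.Maybe using (Maybe; just; nothing)
open import Data.Nat using (zero; _+_; _≤_; _<_; z≤n; s≤s)
import Data.Nat.Properties as ℕP
open import Data.Nat.Tactic.RingSolver using (solve-∀)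
open import Data.Product using (Σ; ∃₂; _,_; proj₁; proj₂)
open import Data.Sum using (_⊎_; inj₁; inj₂)
open import Data.Unit using (⊤; tt)
open import Function.Bundles using (mk⇔)
open import Function.Base using (_∘_)
open import Relation.Binary.Definitions using (tri<; tri≈; tri>)
open import Relation.Binary.PropositionalEquality
  using (_≡_; _≢_; refl; sym; trans; cong; cong₂; subst; module ≡-Reasoning)
import Relation.Binary.Reasoning.Setoid as SetoidReasoning
open import Relation.Nullary using (¬_; Dec; yes; no)
open import Relation.Nullary.Decidable using (⌊_⌋)
open import Level using (0ℓ)

-- The ring of polynomials with coefficientwise equality

-- A record rather than _≐_, so that both polynomials can be inferred from a proof.
infix 4 _≈_
record _≈_ (p q : Poly) : Set where
  constructor coeffwise
  field coeff-≈ : ∀ k → coeff p k ≡ coeff q k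
open _≈_ public

≈-refl : ∀ {p} → p ≈ p
≈-refl = coeffwise λ k → refl
≈-sym : ∀ {p q} → p ≈ q → q ≈ p
≈-sym e = coeffwise λ k → sym (coeff-≈ e k)
≈-trans : ∀ {p q r} → p ≈ q → q ≈ r → p ≈ r
≈-trans e f = coeffwise λ k → trans (coeff-≈ e k) (coeff-≈ f k)

≡⇒≈ : ∀ {p q} → p ≡ q → p ≈ q
≡⇒≈ refl = ≈-refl

neg : Poly → Poly
neg = map (λ a → -ᶻ a)

coeff-⊕ : ∀ p q k → coeff (p ⊕ q) k ≡ coeff p k +ᶻ coeff q k
coeff-⊕ [] q k = sym (ℤP.+-identityˡ _)
coeff-⊕ (a ∷ p) [] k = sym (ℤP.+-identityʳ _)
coeff-⊕ (a ∷ p) (b ∷ q) zero = refl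
coeff-⊕ (a ∷ p) (b ∷ q) (suc k) = coeff-⊕ p q k

coeff-scale : ∀ c p k → coeff (scale c p) k ≡ c *ᶻ coeff p k
coeff-scale c [] k = sym (ℤP.*-zeroʳ c)
coeff-scale c (a ∷ p) zero = refl
coeff-scale c (a ∷ p) (suc k) = coeff-scale c p k

coeff-neg : ∀ p k → coeff (neg p) k ≡ -ᶻ coeff p k
coeff-neg [] k = refl
coeff-neg (a ∷ p) zero = refl
coeff-neg (a ∷ p) (suc k) = coeff-neg p k

∷-cong : ∀ {a b p q} → a ≡ b → p ≈ q → (a ∷ p) ≈ (b ∷ q)
∷-cong e f = coeffwise λ { zero → e ; (suc k) → coeff-≈ f k }

∷-injectiveʳ : ∀ {a b p q} → (a ∷ p) ≈ (b ∷ q) → p ≈ q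
∷-injectiveʳ e = coeffwise λ k → coeff-≈ e (suc k)

[0]≈[] : (+ 0 ∷ []) ≈ []
[0]≈[] = coeffwise λ { zero → refl ; (suc k) → refl }

⊕-cong : ∀ {p p' q q'} → p ≈ p' → q ≈ q' → (p ⊕ q) ≈ (p' ⊕ q')
⊕-cong {p} {p'} {q} {q'} e f = coeffwise λ k → trans (coeff-⊕ p q k) (trans (cong₂ _+ᶻ_ (coeff-≈ e k) (coeff-≈ f k)) (sym (coeff-⊕ p' q' k)))

⊕-congʳ : ∀ {p p'} q → p ≈ p' → (p ⊕ q) ≈ (p' ⊕ q)
⊕-congʳ q e = ⊕-cong e (≈-refl {q})
⊕-congˡ : ∀ p {q q'} → q ≈ q' → (p ⊕ q) ≈ (p ⊕ q')
⊕-congˡ p e = ⊕-cong (≈-refl {p}) e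

scale-cong : ∀ c {p q} → p ≈ q → scale c p ≈ scale c q
scale-cong c {p} {q} e = coeffwise λ k → trans (coeff-scale c p k) (trans (cong (c *ᶻ_) (coeff-≈ e k)) (sym (coeff-scale c q k)))

neg-cong : ∀ {p q} → p ≈ q → neg p ≈ neg q
neg-cong {p} {q} e = coeffwise λ k → trans (coeff-neg p k) (trans (cong (λ a → -ᶻ a) (coeff-≈ e k)) (sym (coeff-neg q k)))

⊕-assoc : ∀ p q r → ((p ⊕ q) ⊕ r) ≈ (p ⊕ (q ⊕ r))
⊕-assoc p q r = coeffwise λ k → begin
  coeff ((p ⊕ q) ⊕ r) k ≡⟨ coeff-⊕ (p ⊕ q) r k ⟩
  coeff (p ⊕ q) k +ᶻ coeff r k ≡⟨ cong (_+ᶻ coeff r k) (coeff-⊕ p q k) ⟩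
  (coeff p k +ᶻ coeff q k) +ᶻ coeff r k ≡⟨ ℤP.+-assoc (coeff p k) _ _ ⟩
  coeff p k +ᶻ (coeff q k +ᶻ coeff r k) ≡⟨ cong (coeff p k +ᶻ_) (sym (coeff-⊕ q r k)) ⟩
  coeff p k +ᶻ coeff (q ⊕ r) k ≡⟨ sym (coeff-⊕ p (q ⊕ r) k) ⟩
  coeff (p ⊕ (q ⊕ r)) k ∎
  where open ≡-Reasoning

⊕-comm : ∀ p q → (p ⊕ q) ≈ (q ⊕ p)
⊕-comm p q = coeffwise λ k → trans (coeff-⊕ p q k) (trans (ℤP.+-comm (coeff p k) _) (sym (coeff-⊕ q p k)))

⊕-identityʳ : ∀ p → (p ⊕ []) ≈ p
⊕-identityʳ [] = ≈-refl
⊕-identityʳ (a ∷ p) = ≈-refl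

⊕-inverseʳ : ∀ p → (p ⊕ neg p) ≈ []
⊕-inverseʳ p = coeffwise λ k → trans (coeff-⊕ p (neg p) k) (trans (cong (coeff p k +ᶻ_) (coeff-neg p k)) (ℤP.+-inverseʳ (coeff p k)))

⊕-inverseˡ : ∀ p → (neg p ⊕ p) ≈ []
⊕-inverseˡ p = ≈-trans (⊕-comm (neg p) p) (⊕-inverseʳ p)

⊕-swap : ∀ a b c → (a ⊕ (b ⊕ c)) ≈ (b ⊕ (a ⊕ c))
⊕-swap a b c = ≈-trans (≈-sym (⊕-assoc a b c)) (≈-trans (⊕-congʳ c (⊕-comm a b)) (⊕-assoc b a c))

⊕-interchange : ∀ a b c d → ((a ⊕ b) ⊕ (c ⊕ d)) ≈ ((a ⊕ c) ⊕ (b ⊕ d))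
⊕-interchange a b c d = ≈-trans (⊕-assoc a b (c ⊕ d)) (≈-trans (⊕-congˡ a (⊕-swap b c d)) (≈-sym (⊕-assoc a c (b ⊕ d))))

scale-distribˡ : ∀ c p q → scale c (p ⊕ q) ≈ (scale c p ⊕ scale c q)
scale-distribˡ c p q = coeffwise λ k → begin
  coeff (scale c (p ⊕ q)) k ≡⟨ coeff-scale c (p ⊕ q) k ⟩
  c *ᶻ coeff (p ⊕ q) k ≡⟨ cong (c *ᶻ_) (coeff-⊕ p q k) ⟩
  c *ᶻ (coeff p k +ᶻ coeff q k) ≡⟨ ℤP.*-distribˡ-+ c (coeff p k) _ ⟩
  c *ᶻ coeff p k +ᶻ c *ᶻ coeff q k ≡⟨ sym (cong₂ _+ᶻ_ (coeff-scale c p k) (coeff-scale c q k)) ⟩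
  coeff (scale c p) k +ᶻ coeff (scale c q) k ≡⟨ sym (coeff-⊕ (scale c p) (scale c q) k) ⟩
  coeff (scale c p ⊕ scale c q) k ∎
  where open ≡-Reasoning

scale-distribʳ : ∀ a b p → scale (a +ᶻ b) p ≈ (scale a p ⊕ scale b p)
scale-distribʳ a b p = coeffwise λ k → trans (coeff-scale (a +ᶻ b) p k) (trans (ℤP.*-distribʳ-+ (coeff p k) a b)
  (sym (trans (coeff-⊕ (scale a p) (scale b p) k) (cong₂ _+ᶻ_ (coeff-scale a p k) (coeff-scale b p k)))))

scale-scale : ∀ a b p → scale a (scale b p) ≈ scale (a *ᶻ b) p
scale-scale a b p = coeffwise λ k → trans (coeff-scale a (scale b p) k) (trans (cong (a *ᶻ_) (coeff-scale b p k))
  (trans (sym (ℤP.*-assoc a b (coeff p k))) (sym (coeff-scale (a *ᶻ b) p k))))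

scale-zero : ∀ p → scale (+ 0) p ≈ []
scale-zero p = coeffwise λ k → coeff-scale (+ 0) p k

scale-0∷ : ∀ c p → scale c (+ 0 ∷ p) ≈ (+ 0 ∷ scale c p)
scale-0∷ c p = ∷-cong (ℤP.*-zeroʳ c) ≈-refl

zero-⊗ : ∀ p q → p ≈ [] → (p ⊗ q) ≈ []
zero-⊗ [] q e = ≈-refl
zero-⊗ (a ∷ p) q e =
  ≈-trans (⊕-cong {scale a q} {scale (+ 0) q} {+ 0 ∷ (p ⊗ q)} {+ 0 ∷ []} (coeffwise λ k → trans (coeff-scale a q k) (trans (cong (_*ᶻ coeff q k) (coeff-≈ e zero)) (sym (coeff-scale (+ 0) q k))))
                  (∷-cong refl (zero-⊗ p q (∷-injectiveʳ {q = []} (≈-trans e (≈-sym [0]≈[]))))))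
          (≈-trans (⊕-congʳ (+ 0 ∷ []) (scale-zero q)) [0]≈[])

⊗-congʳ : ∀ {p p'} q → p ≈ p' → (p ⊗ q) ≈ (p' ⊗ q)
⊗-congʳ {[]} {[]} q e = ≈-refl
⊗-congʳ {a ∷ p} {[]} q e = zero-⊗ (a ∷ p) q e
⊗-congʳ {[]} {b ∷ p'} q e = ≈-sym (zero-⊗ (b ∷ p') q (≈-sym e))
⊗-congʳ {a ∷ p} {b ∷ p'} q e rewrite coeff-≈ e zero = ⊕-congˡ (scale b q) (∷-cong refl (⊗-congʳ q (∷-injectiveʳ e)))

⊗-congˡ : ∀ p {q q'} → q ≈ q' → (p ⊗ q) ≈ (p ⊗ q')
⊗-congˡ [] e = ≈-refl
⊗-congˡ (a ∷ p) e = ⊕-cong (scale-cong a e) (∷-cong refl (⊗-congˡ p e))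

⊗-cong : ∀ {p p' q q'} → p ≈ p' → q ≈ q' → (p ⊗ q) ≈ (p' ⊗ q')
⊗-cong {p} {p'} {q} {q'} e f = ≈-trans (⊗-congʳ q e) (⊗-congˡ p' f)

⊗-distribʳ : ∀ p p' q → ((p ⊕ p') ⊗ q) ≈ ((p ⊗ q) ⊕ (p' ⊗ q))
⊗-distribʳ [] p' q = ≈-refl
⊗-distribʳ (a ∷ p) [] q = ≈-sym (⊕-identityʳ _)
⊗-distribʳ (a ∷ p) (b ∷ p') q =
  ≈-trans (⊕-cong (scale-distribʳ a b q) (∷-cong refl (⊗-distribʳ p p' q)))
          (⊕-interchange (scale a q) (scale b q) (+ 0 ∷ (p ⊗ q)) (+ 0 ∷ (p' ⊗ q)))

⊗-distribˡ : ∀ p q q' → (p ⊗ (q ⊕ q')) ≈ ((p ⊗ q) ⊕ (p ⊗ q'))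
⊗-distribˡ [] q q' = ≈-refl
⊗-distribˡ (a ∷ p) q q' =
  ≈-trans (⊕-cong (scale-distribˡ a q q') (∷-cong refl (⊗-distribˡ p q q')))
          (⊕-interchange (scale a q) (scale a q') (+ 0 ∷ (p ⊗ q)) (+ 0 ∷ (p ⊗ q')))

⊗-zeroʳ : ∀ p → (p ⊗ []) ≈ []
⊗-zeroʳ [] = ≈-refl
⊗-zeroʳ (a ∷ p) = ≈-trans (∷-cong refl (⊗-zeroʳ p)) [0]≈[]

0∷-⊗ : ∀ s r → ((+ 0 ∷ s) ⊗ r) ≈ (+ 0 ∷ (s ⊗ r))
0∷-⊗ s r = ⊕-congʳ (+ 0 ∷ (s ⊗ r)) (scale-zero r)

scale-⊗ : ∀ c p q → (scale c p ⊗ q) ≈ scale c (p ⊗ q)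
scale-⊗ c [] q = ≈-refl
scale-⊗ c (a ∷ p) q =
  ≈-trans (⊕-cong (≈-sym (scale-scale c a q)) (∷-cong refl (scale-⊗ c p q)))
  (≈-trans (⊕-congˡ (scale c (scale a q)) (≈-sym (scale-0∷ c (p ⊗ q)))) (≈-sym (scale-distribˡ c (scale a q) (+ 0 ∷ (p ⊗ q)))))

⊗-∷ : ∀ q a p → (q ⊗ (a ∷ p)) ≈ (scale a q ⊕ (+ 0 ∷ (q ⊗ p)))
⊗-∷ [] a p = ≈-sym [0]≈[]
⊗-∷ (b ∷ q) a p = ∷-cong (cong (_+ᶻ + 0) (ℤP.*-comm b a))
  (≈-trans (⊕-congˡ (scale b p) (⊗-∷ q a p)) (⊕-swap (scale b p) (scale a q) (+ 0 ∷ (q ⊗ p))))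

⊗-comm : ∀ p q → (p ⊗ q) ≈ (q ⊗ p)
⊗-comm [] q = ≈-sym (⊗-zeroʳ q)
⊗-comm (a ∷ p) q = ≈-trans (⊕-congˡ (scale a q) (∷-cong refl (⊗-comm p q))) (≈-sym (⊗-∷ q a p))

⊗-assoc : ∀ p q r → ((p ⊗ q) ⊗ r) ≈ (p ⊗ (q ⊗ r))
⊗-assoc [] q r = ≈-refl
⊗-assoc (a ∷ p) q r =
  ≈-trans (⊗-distribʳ (scale a q) (+ 0 ∷ (p ⊗ q)) r)
  (⊕-cong (scale-⊗ a q r) (≈-trans (0∷-⊗ (p ⊗ q) r) (∷-cong refl (⊗-assoc p q r))))

⊗-identityˡ : ∀ p → (const (+ 1) ⊗ p) ≈ p
⊗-identityˡ p = coeffwise λ k → trans (coeff-⊕ (scale (+ 1) p) (+ 0 ∷ []) k)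
  (trans (cong₂ _+ᶻ_ (coeff-scale (+ 1) p k) (coeff-≈ [0]≈[] k)) (trans (ℤP.+-identityʳ _) (ℤP.*-identityˡ _)))

⊗-identityʳ : ∀ p → (p ⊗ const (+ 1)) ≈ p
⊗-identityʳ p = ≈-trans (⊗-comm p (const (+ 1))) (⊗-identityˡ p)

isCommutativeRing : IsCommutativeRing _≈_ _⊕_ _⊗_ neg [] (const (+ 1))
isCommutativeRing = record
  { isRing = record
    { +-isAbelianGroup = record
      { isGroup = record
        { isMonoid = record
          { isSemigroup = record
            { isMagma = record
              { isEquivalence = record { refl = ≈-refl ; sym = ≈-sym ; trans = ≈-trans }
              ; ∙-cong = ⊕-cong }
            ; assoc = ⊕-assoc }
          ; identity = (λ p → ≈-refl) , ⊕-identityʳ }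
        ; inverse = ⊕-inverseˡ , ⊕-inverseʳ
        ; ⁻¹-cong = neg-cong }
      ; comm = ⊕-comm }
    ; *-cong = ⊗-cong
    ; *-assoc = ⊗-assoc
    ; *-identity = ⊗-identityˡ , ⊗-identityʳ
    ; distrib = ⊗-distribˡ , (λ q p p' → ⊗-distribʳ p p' q) }
  ; *-comm = ⊗-comm }

polyRing : CommutativeRing 0ℓ 0ℓ
polyRing = record { isCommutativeRing = isCommutativeRing }

polyACR : AlmostCommutativeRing 0ℓ 0ℓ
polyACR = fromCommutativeRing polyRing

ℤ-rawRing : RawRing 0ℓ 0ℓ
ℤ-rawRing = CommutativeRing.rawRing ℤP.+-*-commutativeRing

const-morphism : ℤ-rawRing -Raw-AlmostCommutative⟶ polyACR
const-morphism = record
  { ⟦_⟧ = const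
  ; +-homo = λ a b → ≈-refl
  ; *-homo = λ a b → ∷-cong (sym (ℤP.+-identityʳ _)) ≈-refl
  ; -‿homo = λ a → ≈-refl
  ; 0-homo = [0]≈[]
  ; 1-homo = ≈-refl }

const-cong : ∀ {a b} → a ≡ b → const a ≈ const b
const-cong refl = ≈-refl

const-ℕ* : ∀ m n → const (+ (m * n)) ≈ (const (+ m) ⊗ const (+ n))
const-ℕ* m n = ≈-trans (const-cong (ℤP.pos-* m n)) (∷-cong (sym (ℤP.+-identityʳ _)) ≈-refl)

const-≟ : ∀ a b → Maybe (const a ≈ const b)
const-≟ a b with a ℤP.≟ b
... | yes refl = just ≈-refl
... | no _ = nothing

open RingSolver ℤ-rawRing polyACR const-morphism const-≟ using (solve; _:=_; _:+_; _:*_; _:-_; :-_; con)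

evenWeight oddWeight : ℕ → ℕ
evenWeight j = 2 ^ j * (2 * j) !
oddWeight  j = 2 ^ j * (suc (2 * j)) !

oddWeight≡ : ∀ j → oddWeight j ≡ suc (2 * j) * evenWeight j
oddWeight≡ j = lemma (2 ^ j) (2 * j) ((2 * j) !)
  where
  lemma : ∀ p t f → p * (suc t * f) ≡ suc t * (p * f)
  lemma = solve-∀

evenWeight-suc : ∀ j → 4 * suc j * oddWeight j ≡ evenWeight (suc j)
evenWeight-suc j = begin
  4 * suc j * (2 ^ j * (suc (2 * j)) !)  ≡⟨ lemma j (2 ^ j) ((suc (2 * j)) !) ⟩
  2 * 2 ^ j * (suc (suc (2 * j))) !      ≡⟨ cong (λ m → 2 * 2 ^ j * m !) (sym (ℕP.*-suc 2 j)) ⟩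
  2 * 2 ^ j * (2 * suc j) !              ∎
  where
  open ≡-Reasoning
  lemma : ∀ j p f → 4 * suc j * (p * f) ≡ 2 * p * (suc (suc (2 * j)) * f)
  lemma = solve-∀

shiftedTerm : ℕ → ℕ → ℕ
shiftedTerm n zero    = 0
shiftedTerm n (suc j) = evenWeight (suc j) * V n j

V-recurrence-weighted : ∀ n j →
  suc (2 * j) * (oddWeight j * V n j) + shiftedTerm n j ≡ evenWeight j * V (suc n) j
V-recurrence-weighted n zero = lemma (V n 0)
  where
  lemma : ∀ v → 1 * (1 * v) + 0 ≡ 1 * v
  lemma = solve-∀
V-recurrence-weighted n (suc j) = begin
  s * (oddWeight (suc j) * V n (suc j)) + e * V n j  ≡⟨ cong (λ o → s * (o * V n (suc j)) + e * V n j) (oddWeight≡ (suc j)) ⟩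
  s * (s * e * V n (suc j)) + e * V n j              ≡⟨ lemma s e (V n j) (V n (suc j)) ⟩
  e * (V n j + s ^ 2 * V n (suc j))                  ≡⟨ cong (λ t → e * (V n j + t ^ 2 * V n (suc j))) (ℕP.+-comm 1 (2 * suc j)) ⟩
  e * V (suc n) (suc j)                              ∎
  where
  open ≡-Reasoning
  s = suc (2 * suc j)
  e = evenWeight (suc j)
  lemma : ∀ p q a b → p * (p * q * b) + q * a ≡ q * (a + p * (p * 1) * b)
  lemma = solve-∀

V-vanishes : ∀ n k → n < k → V n k ≡ 0
V-vanishes zero    (suc k) _ = refl
V-vanishes (suc n) (suc k) (s≤s n<k)
  rewrite V-vanishes n k n<k | V-vanishes n (suc k) (ℕP.m≤n⇒m≤1+n n<k) = ℕP.*-zeroʳ ((2 * suc k + 1) ^ 2)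

-- Formal derivative and the recurrence operator

module ≈-Reasoning = SetoidReasoning (CommutativeRing.setoid polyRing)

0∷≈X⊗ : ∀ s → (+ 0 ∷ s) ≈ (X ⊗ s)
0∷≈X⊗ s = ≈-sym (≈-trans (⊕-congʳ (+ 0 ∷ ((+ 1 ∷ []) ⊗ s)) (scale-zero s)) (∷-cong refl (⊗-identityˡ s)))

scale≈const⊗ : ∀ c p → scale c p ≈ (const c ⊗ p)
scale≈const⊗ c p = ≈-sym (≈-trans (⊕-congˡ (scale c p) [0]≈[]) (⊕-identityʳ (scale c p)))

∂ : Poly → Poly
∂ [] = []
∂ (a ∷ p) = p ⊕ (+ 0 ∷ ∂ p)

∂-zero : ∀ p → p ≈ [] → ∂ p ≈ []
∂-zero [] e = ≈-refl
∂-zero (a ∷ p) e = ≈-trans (⊕-cong (∷-injectiveʳ {q = []} (≈-trans e (≈-sym [0]≈[]))) (∷-cong refl (∂-zero p (∷-injectiveʳ {q = []} (≈-trans e (≈-sym [0]≈[])))))) [0]≈[]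

∂-cong : ∀ {p q} → p ≈ q → ∂ p ≈ ∂ q
∂-cong {[]} {[]} e = ≈-refl
∂-cong {a ∷ p} {[]} e = ∂-zero (a ∷ p) e
∂-cong {[]} {b ∷ q} e = ≈-sym (∂-zero (b ∷ q) (≈-sym e))
∂-cong {a ∷ p} {b ∷ q} e = ⊕-cong (∷-injectiveʳ e) (∷-cong refl (∂-cong (∷-injectiveʳ e)))

∂-⊕ : ∀ p q → ∂ (p ⊕ q) ≈ (∂ p ⊕ ∂ q)
∂-⊕ [] q = ≈-refl
∂-⊕ (a ∷ p) [] = ≈-sym (⊕-identityʳ _)
∂-⊕ (a ∷ p) (b ∷ q) = ≈-trans (⊕-congˡ (p ⊕ q) (∷-cong refl (∂-⊕ p q)))
  (⊕-interchange p q (+ 0 ∷ ∂ p) (+ 0 ∷ ∂ q))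

∂-scale : ∀ c p → ∂ (scale c p) ≈ scale c (∂ p)
∂-scale c [] = ≈-refl
∂-scale c (a ∷ p) = ≈-trans (⊕-congˡ (scale c p) (∷-cong refl (∂-scale c p)))
  (≈-trans (⊕-congˡ (scale c p) (≈-sym (scale-0∷ c (∂ p)))) (≈-sym (scale-distribˡ c p (+ 0 ∷ ∂ p))))

∂-⊗ : ∀ p q → ∂ (p ⊗ q) ≈ ((∂ p ⊗ q) ⊕ (p ⊗ ∂ q))
∂-⊗ [] q = ≈-refl
∂-⊗ (a ∷ p) q = begin
  ∂ (scale a q ⊕ (+ 0 ∷ (p ⊗ q))) ≈⟨ ∂-⊕ (scale a q) (+ 0 ∷ (p ⊗ q)) ⟩
  ∂ (scale a q) ⊕ ((p ⊗ q) ⊕ (+ 0 ∷ ∂ (p ⊗ q))) ≈⟨ ⊕-cong (≈-trans (∂-scale a q) (scale≈const⊗ a (∂ q))) (⊕-congˡ (p ⊗ q) (≈-trans (∷-cong refl (∂-⊗ p q)) (0∷≈X⊗ _))) ⟩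
  (const a ⊗ ∂ q) ⊕ ((p ⊗ q) ⊕ (X ⊗ ((∂ p ⊗ q) ⊕ (p ⊗ ∂ q)))) ≈⟨ solve 6 (λ A P Q DP DQ x → (A :* DQ) :+ ((P :* Q) :+ (x :* ((DP :* Q) :+ (P :* DQ)))) := ((P :+ (x :* DP)) :* Q) :+ ((A :* DQ) :+ (x :* (P :* DQ)))) ≈-refl (const a) p q (∂ p) (∂ q) X ⟩
  ((p ⊕ (X ⊗ ∂ p)) ⊗ q) ⊕ ((const a ⊗ ∂ q) ⊕ (X ⊗ (p ⊗ ∂ q))) ≈⟨ ⊕-cong (⊗-congʳ q (⊕-congˡ p (≈-sym (0∷≈X⊗ (∂ p))))) (⊕-cong (≈-sym (scale≈const⊗ a (∂ q))) (≈-sym (0∷≈X⊗ (p ⊗ ∂ q)))) ⟩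
  ((p ⊕ (+ 0 ∷ ∂ p)) ⊗ q) ⊕ (scale a (∂ q) ⊕ (+ 0 ∷ (p ⊗ ∂ q))) ∎
  where open ≈-Reasoning

x[1-x²] : Poly
x[1-x²] = X ⊗ (1+x ⊗ 1-x)

-- x (1 − x²) f′ = g f.  Like a logarithmic derivative, g is additive over products, so Φ can be
-- evaluated on products of powers of x, 1 + x and 1 − x factor by factor.
record LogDeriv (f g : Poly) : Set where
  constructor logDeriv
  field logDeriv-eq : (x[1-x²] ⊗ ∂ f) ≈ (g ⊗ f)
open LogDeriv public

LogDeriv-resp : ∀ {f g g'} → LogDeriv f g → g ≈ g' → LogDeriv f g'
LogDeriv-resp {f} e h = logDeriv (≈-trans (logDeriv-eq e) (⊗-congʳ f h))

LogDeriv-⊗ : ∀ {f1 g1 f2 g2} → LogDeriv f1 g1 → LogDeriv f2 g2 → LogDeriv (f1 ⊗ f2) (g1 ⊕ g2)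
LogDeriv-⊗ {f1} {g1} {f2} {g2} e1 e2 = logDeriv (begin
  x[1-x²] ⊗ ∂ (f1 ⊗ f2) ≈⟨ ⊗-congˡ x[1-x²] (∂-⊗ f1 f2) ⟩
  x[1-x²] ⊗ ((∂ f1 ⊗ f2) ⊕ (f1 ⊗ ∂ f2)) ≈⟨ solve 5 (λ W D1 D2 F1 F2 → W :* ((D1 :* F2) :+ (F1 :* D2)) := ((W :* D1) :* F2) :+ (F1 :* (W :* D2))) ≈-refl x[1-x²] (∂ f1) (∂ f2) f1 f2 ⟩
  ((x[1-x²] ⊗ ∂ f1) ⊗ f2) ⊕ (f1 ⊗ (x[1-x²] ⊗ ∂ f2)) ≈⟨ ⊕-cong (⊗-congʳ f2 (logDeriv-eq e1)) (⊗-congˡ f1 (logDeriv-eq e2)) ⟩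
  ((g1 ⊗ f1) ⊗ f2) ⊕ (f1 ⊗ (g2 ⊗ f2)) ≈⟨ solve 4 (λ G1 G2 F1 F2 → ((G1 :* F1) :* F2) :+ (F1 :* (G2 :* F2)) := (G1 :+ G2) :* (F1 :* F2)) ≈-refl g1 g2 f1 f2 ⟩
  (g1 ⊕ g2) ⊗ (f1 ⊗ f2) ∎)
  where open ≈-Reasoning

∂X : ∂ X ≈ const (+ 1)
∂X = ∷-cong refl [0]≈[]

LogDeriv-X : LogDeriv X (1+x ⊗ 1-x)
LogDeriv-X = logDeriv (≈-trans (⊗-congˡ x[1-x²] ∂X) (≈-trans (⊗-identityʳ x[1-x²]) (⊗-comm X (1+x ⊗ 1-x))))

LogDeriv-const : ∀ c → LogDeriv (const c) (const (+ 0))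
LogDeriv-const c = logDeriv (≈-trans (⊗-congˡ x[1-x²] [0]≈[]) (≈-trans (⊗-zeroʳ x[1-x²]) (≈-sym (zero-⊗ (const (+ 0)) (const c) [0]≈[]))))

∂1+x : ∂ 1+x ≈ const (+ 1)
∂1+x = ∷-cong refl [0]≈[]

∂1-x : ∂ 1-x ≈ const -[1+ 0 ]
∂1-x = ∷-cong refl [0]≈[]

LogDeriv-1+x : LogDeriv 1+x (X ⊗ 1-x)
LogDeriv-1+x = logDeriv (≈-trans (⊗-congˡ x[1-x²] ∂1+x) (≈-trans (⊗-identityʳ x[1-x²])
  (solve 3 (λ x P M → x :* (P :* M) := (x :* M) :* P) ≈-refl X 1+x 1-x)))

LogDeriv-1-x : LogDeriv 1-x (neg (X ⊗ 1+x))
LogDeriv-1-x = logDeriv (≈-trans (⊗-congˡ x[1-x²] ∂1-x)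
  (solve 3 (λ x P M → (x :* (P :* M)) :* con (-[1+ 0 ]) := (:- (x :* P)) :* M) ≈-refl X 1+x 1-x))

LogDeriv-^^ : ∀ {f g} m → LogDeriv f g → LogDeriv (f ^^ m) (const (+ m) ⊗ g)
LogDeriv-^^ {f} {g} zero e = LogDeriv-resp (LogDeriv-const (+ 1)) (≈-trans [0]≈[] (≈-sym (zero-⊗ (const (+ 0)) g [0]≈[])))
LogDeriv-^^ {f} {g} (suc m) e = LogDeriv-resp (LogDeriv-⊗ e (LogDeriv-^^ m e))
  (solve 2 (λ G K → G :+ (K :* G) := (con (+ 1) :+ K) :* G) ≈-refl g (const (+ m)))

linearPart : ℕ → Poly
linearPart M = (const -[1+ 0 ] ⊕ (const (+ 3) ⊗ X)) ⊕ (const (+ (2 * M)) ⊗ (X ⊗ X))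

Φ : ℕ → Poly → Poly
Φ M P = (const (+ 2) ⊗ (x[1-x²] ⊗ ∂ P)) ⊕ (linearPart M ⊗ P)

Φ-LogDeriv : ∀ M {f g} → LogDeriv f g → Φ M f ≈ (((const (+ 2) ⊗ g) ⊕ linearPart M) ⊗ f)
Φ-LogDeriv M {f} {g} e = ≈-trans (⊕-congʳ (linearPart M ⊗ f) (⊗-congˡ (const (+ 2)) (logDeriv-eq e)))
  (solve 3 (λ G F L → (con (+ 2) :* (G :* F)) :+ (L :* F) := ((con (+ 2) :* G) :+ L) :* F) ≈-refl g f (linearPart M))

Φ-cong : ∀ M {p q} → p ≈ q → Φ M p ≈ Φ M q
Φ-cong M {p} {q} e = ⊕-cong (⊗-congˡ (const (+ 2)) (⊗-congˡ x[1-x²] (∂-cong e))) (⊗-congˡ (linearPart M) e)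

Φ-⊕ : ∀ M p q → Φ M (p ⊕ q) ≈ (Φ M p ⊕ Φ M q)
Φ-⊕ M p q = ≈-trans (⊕-congʳ (linearPart M ⊗ (p ⊕ q)) (⊗-congˡ (const (+ 2)) (⊗-congˡ x[1-x²] (∂-⊕ p q))))
  (solve 6 (λ W DP DQ L P Q → (con (+ 2) :* (W :* (DP :+ DQ))) :+ (L :* (P :+ Q)) := ((con (+ 2) :* (W :* DP)) :+ (L :* P)) :+ ((con (+ 2) :* (W :* DQ)) :+ (L :* Q))) ≈-refl x[1-x²] (∂ p) (∂ q) (linearPart M) p q)

Φ-[] : ∀ M → Φ M [] ≈ []
Φ-[] M = ⊕-cong (≈-trans (⊗-congˡ (const (+ 2)) (⊗-zeroʳ x[1-x²])) (⊗-zeroʳ (const (+ 2)))) (⊗-zeroʳ (linearPart M))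

sumP-cong : ∀ n {f g : ℕ → Poly} → (∀ j → j ≤ n → f j ≈ g j) → sumP 0 n f ≈ sumP 0 n g
sumP-cong zero h = h 0 z≤n
sumP-cong (suc n) h = ⊕-cong (sumP-cong n (λ j j≤n → h j (ℕP.m≤n⇒m≤1+n j≤n))) (h (suc n) ℕP.≤-refl)

sumP-⊕ : ∀ n (f g : ℕ → Poly) → sumP 0 n (λ j → f j ⊕ g j) ≈ (sumP 0 n f ⊕ sumP 0 n g)
sumP-⊕ zero f g = ≈-refl
sumP-⊕ (suc n) f g = ≈-trans (⊕-congʳ _ (sumP-⊕ n f g)) (⊕-interchange (sumP 0 n f) (sumP 0 n g) (f (suc n)) (g (suc n)))

⊗-sumP : ∀ p n (f : ℕ → Poly) → (p ⊗ sumP 0 n f) ≈ sumP 0 n (λ j → p ⊗ f j)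
⊗-sumP p zero f = ≈-refl
⊗-sumP p (suc n) f = ≈-trans (⊗-distribˡ p (sumP 0 n f) (f (suc n))) (⊕-congʳ _ (⊗-sumP p n f))

Φ-sumP : ∀ M n (f : ℕ → Poly) → Φ M (sumP 0 n f) ≈ sumP 0 n (λ j → Φ M (f j))
Φ-sumP M zero f = ≈-refl
Φ-sumP M (suc n) f = ≈-trans (Φ-⊕ M (sumP 0 n f) (f (suc n))) (⊕-congʳ _ (Φ-sumP M n f))

sumP-shift : ∀ n (f : ℕ → Poly) → sumP 0 (suc n) f ≈ (f 0 ⊕ sumP 0 n (λ j → f (suc j)))
sumP-shift zero f = ≈-refl
sumP-shift (suc n) f = ≈-trans (⊕-congʳ _ (sumP-shift n f)) (⊕-assoc (f 0) _ _)

-- The right-hand sides satisfy the recurrence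

rhsTerm : (ℕ → ℕ) → ℕ → ℕ → Poly
rhsTerm c n j = const (+ (c j * V n j)) ⊗ ((X ^^ j) ⊗ (1-x ^^ (n ∸ j)))

rhsPoly≈sumP : ∀ n e c → rhsPoly n e c ≈ sumP 0 n (λ j → X ⊗ ((1+x ^^ e) ⊗ rhsTerm c n j))
rhsPoly≈sumP n e c = ≈-trans (⊗-congˡ X (⊗-sumP (1+x ^^ e) n (rhsTerm c n))) (⊗-sumP X n _)

rhsTermLogDeriv : ℕ → ℕ → ℕ → Poly
rhsTermLogDeriv e j k =
  (1+x ⊗ 1-x) ⊕ ((const (+ e) ⊗ (X ⊗ 1-x)) ⊕ (const (+ 0) ⊕ ((const (+ j) ⊗ (1+x ⊗ 1-x)) ⊕ (const (+ k) ⊗ neg (X ⊗ 1+x)))))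

LogDeriv-rhsTerm : ∀ e γ j k →
  LogDeriv (X ⊗ ((1+x ^^ e) ⊗ (const γ ⊗ ((X ^^ j) ⊗ (1-x ^^ k))))) (rhsTermLogDeriv e j k)
LogDeriv-rhsTerm e γ j k =
  LogDeriv-⊗ LogDeriv-X (LogDeriv-⊗ (LogDeriv-^^ e LogDeriv-1+x)
    (LogDeriv-⊗ (LogDeriv-const γ) (LogDeriv-⊗ (LogDeriv-^^ j LogDeriv-X) (LogDeriv-^^ k LogDeriv-1-x))))

odd-factor : ∀ j c → ((const (+ 1) ⊕ (const (+ 2) ⊗ const (+ j))) ⊗ const (+ c)) ≈ const (+ (suc (2 * j) * c))
odd-factor j c = ≈-trans (⊗-congʳ (const (+ c)) (⊕-congˡ (const (+ 1)) (≈-sym (const-ℕ* 2 j))))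
                         (≈-sym (const-ℕ* (suc (2 * j)) c))

four-factor : ∀ j c → ((const (+ 4) ⊗ (const (+ 1) ⊕ const (+ j))) ⊗ const (+ c)) ≈ const (+ (4 * suc j * c))
four-factor j c = ≈-trans (⊗-congʳ (const (+ c)) (≈-sym (const-ℕ* 4 (suc j)))) (≈-sym (const-ℕ* (4 * suc j) c))

Φ-rhsTerm-odd : ∀ m j → j ≤ suc m →
  Φ (2 * suc m) (X ⊗ ((1+x ^^ m) ⊗ rhsTerm evenWeight (suc m) j)) ≈ (X ⊗ ((1+x ^^ suc m) ⊗ rhsTerm oddWeight (suc m) j))
Φ-rhsTerm-odd m j j≤ = begin
  Φ M T ≈⟨ Φ-LogDeriv M (LogDeriv-rhsTerm m (+ γ) j k) ⟩
  ((const (+ 2) ⊗ rhsTermLogDeriv m j k) ⊕ linearPart M) ⊗ T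
    ≈⟨ ⊗-congʳ T (⊕-cong (⊗-congˡ (const (+ 2)) (⊕-congˡ (1+x ⊗ 1-x) (⊕-congʳ rest (⊗-congʳ (X ⊗ 1-x) m≈))))
                         (⊕-congˡ (const -[1+ 0 ] ⊕ (const (+ 3) ⊗ X)) (⊗-congʳ (X ⊗ X) 2M≈))) ⟩
  ((const (+ 2) ⊗ ((1+x ⊗ 1-x) ⊕ ((((J ⊕ K) ⊕ const -[1+ 0 ]) ⊗ (X ⊗ 1-x)) ⊕ rest))) ⊕ ((const -[1+ 0 ] ⊕ (const (+ 3) ⊗ X)) ⊕ ((const (+ 4) ⊗ (J ⊕ K)) ⊗ (X ⊗ X)))) ⊗ T
    ≈⟨ solve 7 (λ x u C y z J K →
         ((con (+ 2) :* (((con (+ 1) :+ x) :* (con (+ 1) :- x)) :+ ((((J :+ K) :+ con -[1+ 0 ]) :* (x :* (con (+ 1) :- x))) :+ (con (+ 0) :+ ((J :* ((con (+ 1) :+ x) :* (con (+ 1) :- x))) :+ (K :* (:- (x :* (con (+ 1) :+ x))))))))) :+ ((con -[1+ 0 ] :+ (con (+ 3) :* x)) :+ ((con (+ 4) :* (J :+ K)) :* (x :* x)))) :* (x :* (u :* (C :* (y :* z))))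
         := x :* (((con (+ 1) :+ x) :* u) :* (((con (+ 1) :+ (con (+ 2) :* J)) :* C) :* (y :* z)))) ≈-refl X u C y z J K ⟩
  X ⊗ ((1+x ⊗ u) ⊗ (((const (+ 1) ⊕ (const (+ 2) ⊗ J)) ⊗ C) ⊗ (y ⊗ z)))
    ≈⟨ ⊗-congˡ X (⊗-congˡ (1+x ⊗ u) (⊗-congʳ (y ⊗ z) (≈-trans (odd-factor j γ) (const-cong (cong +_ (sym oddWeight-V)))))) ⟩
  X ⊗ ((1+x ⊗ u) ⊗ (const (+ (oddWeight j * V (suc m) j)) ⊗ (y ⊗ z))) ∎
  where
  open ≈-Reasoning
  M = 2 * suc m
  k = suc m ∸ j
  γ = evenWeight j * V (suc m) j
  u = 1+x ^^ m
  C = const (+ γ)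
  y = X ^^ j
  z = 1-x ^^ k
  J = const (+ j)
  K = const (+ k)
  T = X ⊗ (u ⊗ (C ⊗ (y ⊗ z)))
  rest = const (+ 0) ⊕ ((J ⊗ (1+x ⊗ 1-x)) ⊕ (K ⊗ neg (X ⊗ 1+x)))
  j+k≡1+m : j + k ≡ suc m
  j+k≡1+m = ℕP.m+[n∸m]≡n j≤
  m≈ : const (+ m) ≈ ((J ⊕ K) ⊕ const -[1+ 0 ])
  m≈ = const-cong (cong (λ t → + t +ᶻ -[1+ 0 ]) (sym j+k≡1+m))
  2M≈ : const (+ (2 * M)) ≈ (const (+ 4) ⊗ (J ⊕ K))
  2M≈ = ≈-trans (const-cong (cong +_ (trans (cong (λ t → 2 * (2 * t)) (sym j+k≡1+m)) (lemma (j + k))))) (const-ℕ* 4 (j + k))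
    where
    lemma : ∀ t → 2 * (2 * t) ≡ 4 * t
    lemma = solve-∀
  oddWeight-V : oddWeight j * V (suc m) j ≡ suc (2 * j) * γ
  oddWeight-V = trans (cong (_* V (suc m) j) (oddWeight≡ j)) (ℕP.*-assoc (suc (2 * j)) (evenWeight j) (V (suc m) j))

Φ-rhsPoly-odd : ∀ m → Φ (2 * suc m) (rhsPoly (suc m) m evenWeight) ≈ rhsPoly (suc m) (suc m) oddWeight
Φ-rhsPoly-odd m = begin
  Φ M (rhsPoly (suc m) m evenWeight)                                ≈⟨ Φ-cong M (rhsPoly≈sumP (suc m) m evenWeight) ⟩
  Φ M (sumP 0 (suc m) (λ j → X ⊗ ((1+x ^^ m) ⊗ rhsTerm evenWeight (suc m) j)))  ≈⟨ Φ-sumP M (suc m) _ ⟩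
  sumP 0 (suc m) (λ j → Φ M (X ⊗ ((1+x ^^ m) ⊗ rhsTerm evenWeight (suc m) j))) ≈⟨ sumP-cong (suc m) (Φ-rhsTerm-odd m) ⟩
  sumP 0 (suc m) (λ j → X ⊗ ((1+x ^^ suc m) ⊗ rhsTerm oddWeight (suc m) j))   ≈⟨ ≈-sym (rhsPoly≈sumP (suc m) (suc m) oddWeight) ⟩
  rhsPoly (suc m) (suc m) oddWeight                                 ∎
  where
  open ≈-Reasoning
  M = 2 * suc m

-- Φ sends the j-th odd term to keepTerm n j ⊕ raiseTerm n j;
-- raiseTerm n j belongs to index j + 1 of the even sum.
keepTerm raiseTerm : ℕ → ℕ → Poly
keepTerm  n j = const (+ (suc (2 * j) * (oddWeight j * V n j))) ⊗ ((X ^^ j) ⊗ (1-x ⊗ (1-x ^^ (n ∸ j))))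
raiseTerm n j = const (+ (evenWeight (suc j) * V n j)) ⊗ ((X ⊗ (X ^^ j)) ⊗ (1-x ^^ (n ∸ j)))

Φ-rhsTerm-even : ∀ n j → j ≤ n →
  Φ (suc (2 * n)) (X ⊗ ((1+x ^^ n) ⊗ rhsTerm oddWeight n j)) ≈ (X ⊗ ((1+x ^^ n) ⊗ (keepTerm n j ⊕ raiseTerm n j)))
Φ-rhsTerm-even n j j≤ = begin
  Φ M T ≈⟨ Φ-LogDeriv M (LogDeriv-rhsTerm n (+ γ) j k) ⟩
  ((const (+ 2) ⊗ rhsTermLogDeriv n j k) ⊕ linearPart M) ⊗ T
    ≈⟨ ⊗-congʳ T (⊕-cong (⊗-congˡ (const (+ 2)) (⊕-congˡ (1+x ⊗ 1-x) (⊕-congʳ rest (⊗-congʳ (X ⊗ 1-x) n≈))))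
                         (⊕-congˡ (const -[1+ 0 ] ⊕ (const (+ 3) ⊗ X)) (⊗-congʳ (X ⊗ X) 2M≈))) ⟩
  ((const (+ 2) ⊗ ((1+x ⊗ 1-x) ⊕ (((J ⊕ K) ⊗ (X ⊗ 1-x)) ⊕ rest))) ⊕ ((const -[1+ 0 ] ⊕ (const (+ 3) ⊗ X)) ⊕ ((const (+ 2) ⊕ (const (+ 4) ⊗ (J ⊕ K))) ⊗ (X ⊗ X)))) ⊗ T
    ≈⟨ solve 7 (λ x u C y z J K →
         ((con (+ 2) :* (((con (+ 1) :+ x) :* (con (+ 1) :- x)) :+ (((J :+ K) :* (x :* (con (+ 1) :- x))) :+ (con (+ 0) :+ ((J :* ((con (+ 1) :+ x) :* (con (+ 1) :- x))) :+ (K :* (:- (x :* (con (+ 1) :+ x))))))))) :+ ((con -[1+ 0 ] :+ (con (+ 3) :* x)) :+ ((con (+ 2) :+ (con (+ 4) :* (J :+ K))) :* (x :* x)))) :* (x :* (u :* (C :* (y :* z))))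
         := x :* (u :* ((((con (+ 1) :+ (con (+ 2) :* J)) :* C) :* (y :* ((con (+ 1) :- x) :* z))) :+ (((con (+ 4) :* (con (+ 1) :+ J)) :* C) :* ((x :* y) :* z))))) ≈-refl X u C y z J K ⟩
  X ⊗ (u ⊗ ((((const (+ 1) ⊕ (const (+ 2) ⊗ J)) ⊗ C) ⊗ (y ⊗ (1-x ⊗ z))) ⊕ (((const (+ 4) ⊗ (const (+ 1) ⊕ J)) ⊗ C) ⊗ ((X ⊗ y) ⊗ z))))
    ≈⟨ ⊗-congˡ X (⊗-congˡ u (⊕-cong (⊗-congʳ (y ⊗ (1-x ⊗ z)) (odd-factor j γ))
                                     (⊗-congʳ ((X ⊗ y) ⊗ z) (≈-trans (four-factor j γ) (const-cong (cong +_ evenWeight-V)))))) ⟩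
  X ⊗ (u ⊗ (keepTerm n j ⊕ raiseTerm n j)) ∎
  where
  open ≈-Reasoning
  M = suc (2 * n)
  k = n ∸ j
  γ = oddWeight j * V n j
  u = 1+x ^^ n
  C = const (+ γ)
  y = X ^^ j
  z = 1-x ^^ k
  J = const (+ j)
  K = const (+ k)
  T = X ⊗ (u ⊗ (C ⊗ (y ⊗ z)))
  rest = const (+ 0) ⊕ ((J ⊗ (1+x ⊗ 1-x)) ⊕ (K ⊗ neg (X ⊗ 1+x)))
  j+k≡n : j + k ≡ n
  j+k≡n = ℕP.m+[n∸m]≡n j≤
  n≈ : const (+ n) ≈ (J ⊕ K)
  n≈ = const-cong (cong +_ (sym j+k≡n))
  2M≈ : const (+ (2 * M)) ≈ (const (+ 2) ⊕ (const (+ 4) ⊗ (J ⊕ K)))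
  2M≈ = ≈-trans (const-cong (cong +_ (trans (cong (λ t → 2 * suc (2 * t)) (sym j+k≡n)) (lemma (j + k)))))
                (⊕-congˡ (const (+ 2)) (const-ℕ* 4 (j + k)))
    where
    lemma : ∀ t → 2 * suc (2 * t) ≡ 2 + 4 * t
    lemma = solve-∀
  evenWeight-V : 4 * suc j * γ ≡ evenWeight (suc j) * V n j
  evenWeight-V = trans (sym (ℕP.*-assoc (4 * suc j) (oddWeight j) (V n j))) (cong (_* V n j) (evenWeight-suc j))

sumP-keep-raise : ∀ n → (sumP 0 n (keepTerm n) ⊕ sumP 0 n (raiseTerm n)) ≈ sumP 0 (suc n) (rhsTerm evenWeight (suc n))
sumP-keep-raise n = begin
  sumP 0 n (keepTerm n) ⊕ sumP 0 n (raiseTerm n)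
    ≈⟨ ⊕-cong (≈-trans (sumP-cong n keep≈) (≈-sym (≈-trans (⊕-congˡ (sumP 0 n keep) keep-last) (⊕-identityʳ _))))
              (≈-sym (≈-trans (sumP-shift n raise) (⊕-congʳ (sumP 0 n (raiseTerm n)) raise-first))) ⟩
  sumP 0 (suc n) keep ⊕ sumP 0 (suc n) raise ≈⟨ ≈-sym (sumP-⊕ (suc n) keep raise) ⟩
  sumP 0 (suc n) (λ j → keep j ⊕ raise j)
    ≈⟨ sumP-cong (suc n) (λ j _ → ≈-trans (≈-sym (⊗-distribʳ (const (+ (suc (2 * j) * (oddWeight j * V n j)))) (const (+ shiftedTerm n j)) (f j)))
                                          (⊗-congʳ (f j) (const-cong (cong +_ (V-recurrence-weighted n j))))) ⟩
  sumP 0 (suc n) (rhsTerm evenWeight (suc n)) ∎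
  where
  open ≈-Reasoning
  f : ℕ → Poly
  f j = (X ^^ j) ⊗ (1-x ^^ (suc n ∸ j))
  keep raise : ℕ → Poly
  keep  j = const (+ (suc (2 * j) * (oddWeight j * V n j))) ⊗ f j
  raise j = const (+ shiftedTerm n j) ⊗ f j
  keep≈ : ∀ j → j ≤ n → keepTerm n j ≈ keep j
  keep≈ j j≤ = ⊗-congˡ (const (+ (suc (2 * j) * (oddWeight j * V n j))))
                       (⊗-congˡ (X ^^ j) (≡⇒≈ (cong (1-x ^^_) (sym (ℕP.+-∸-assoc 1 j≤)))))
  keep-last : keep (suc n) ≈ []
  keep-last = zero-⊗ _ (f (suc n)) (≈-trans (const-cong (cong +_ vanishes)) [0]≈[])
    where
    vanishes : suc (2 * suc n) * (oddWeight (suc n) * V n (suc n)) ≡ 0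
    vanishes rewrite V-vanishes n (suc n) ℕP.≤-refl | ℕP.*-zeroʳ (oddWeight (suc n)) = ℕP.*-zeroʳ (suc (2 * suc n))
  raise-first : raise 0 ≈ []
  raise-first = zero-⊗ (const (+ 0)) (f 0) [0]≈[]

Φ-rhsPoly-even : ∀ n → Φ (suc (2 * n)) (rhsPoly n n oddWeight) ≈ rhsPoly (suc n) n evenWeight
Φ-rhsPoly-even n = begin
  Φ M (rhsPoly n n oddWeight)                              ≈⟨ Φ-cong M (rhsPoly≈sumP n n oddWeight) ⟩
  Φ M (sumP 0 n (λ j → X ⊗ (u ⊗ rhsTerm oddWeight n j)))    ≈⟨ Φ-sumP M n _ ⟩
  sumP 0 n (λ j → Φ M (X ⊗ (u ⊗ rhsTerm oddWeight n j)))    ≈⟨ sumP-cong n (Φ-rhsTerm-even n) ⟩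
  sumP 0 n (λ j → X ⊗ (u ⊗ (keepTerm n j ⊕ raiseTerm n j))) ≈⟨ ≈-sym (≈-trans (⊗-congˡ X (⊗-sumP u n _)) (⊗-sumP X n _)) ⟩
  X ⊗ (u ⊗ sumP 0 n (λ j → keepTerm n j ⊕ raiseTerm n j))
    ≈⟨ ⊗-congˡ X (⊗-congˡ u (≈-trans (sumP-⊕ n (keepTerm n) (raiseTerm n)) (sumP-keep-raise n))) ⟩
  X ⊗ (u ⊗ sumP 0 (suc n) (rhsTerm evenWeight (suc n)))     ∎
  where
  open ≈-Reasoning
  M = suc (2 * n)
  u = 1+x ^^ n

InPm : ℕ → ℤ → Set
InPm n x = (x ≢ + 0) × (∣ x ∣ ≤ n)

negSuc : ℕ → ℤ
negSuc i = -ᶻ (+ suc i)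
posSuc : ℕ → ℤ
posSuc i = + suc i

∈-pmSet⁺ : ∀ {n x} → InPm n x → x ∈ pmSet n
∈-pmSet⁺ {n} {+ zero} (nz , _) = ⊥-elim (nz refl)
∈-pmSet⁺ {n} {+ suc i} (_ , le) = ∈-++⁺ʳ (map negSuc (upTo n)) (∈-map⁺ posSuc (∈-upTo⁺ le))
∈-pmSet⁺ {n} { -[1+ i ]} (_ , le) = ∈-++⁺ˡ (∈-map⁺ negSuc (∈-upTo⁺ le))

∈-pmSet⁻ : ∀ {n x} → x ∈ pmSet n → InPm n x
∈-pmSet⁻ {n} {x} p with ∈-++⁻ (map negSuc (upTo n)) p
... | inj₁ q with ∈-map⁻ negSuc q
...   | i , i∈ , refl = (λ ()) , ∈-upTo⁻ i∈
∈-pmSet⁻ {n} {x} p | inj₂ q with ∈-map⁻ posSuc q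
...   | i , i∈ , refl = (λ ()) , ∈-upTo⁻ i∈

InPm-suc : ∀ {n x} → InPm n x → InPm (suc n) x
InPm-suc (nz , le) = nz , ℕP.m≤n⇒m≤1+n le

InPm-neg : ∀ {n x} → InPm n x → InPm n (-ᶻ x)
InPm-neg {n} {x} (nz , le) = (λ e → nz (trans (sym (ℤP.neg-involutive x)) (cong -ᶻ_ e))) , subst (_≤ n) (sym (ℤP.∣-i∣≡∣i∣ x)) le

consAll : List ℤ → List (List ℤ) → List (List ℤ)
consAll P W = concatMap (λ a → map (a ∷_) W) P

∈-consAll⁺ : ∀ {a w} P W → a ∈ P → w ∈ W → (a ∷ w) ∈ consAll P W
∈-consAll⁺ (p ∷ P) W (here refl) w∈ = ∈-++⁺ˡ (∈-map⁺ (p ∷_) w∈)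
∈-consAll⁺ (p ∷ P) W (there a∈) w∈ = ∈-++⁺ʳ (map (p ∷_) W) (∈-consAll⁺ P W a∈ w∈)

∈-consAll⁻ : ∀ {v} P W → v ∈ consAll P W → ∃₂ λ a w → a ∈ P × w ∈ W × v ≡ a ∷ w
∈-consAll⁻ (p ∷ P) W v∈ with ∈-++⁻ (map (p ∷_) W) v∈
... | inj₁ q with ∈-map⁻ (p ∷_) q
...   | w , w∈ , refl = p , w , here refl , w∈ , refl
∈-consAll⁻ (p ∷ P) W v∈ | inj₂ q with ∈-consAll⁻ P W q
...   | a , w , a∈ , w∈ , e = a , w , there a∈ , w∈ , e

∈-words⁺ : ∀ n m v → length v ≡ m → All (_∈ pmSet n) v → v ∈ words n m
∈-words⁺ n zero [] refl [] = here refl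
∈-words⁺ n (suc m) (a ∷ v) refl (a∈ ∷ as) = ∈-consAll⁺ (pmSet n) (words n m) a∈ (∈-words⁺ n m v refl as)

∈-words⁻ : ∀ n m v → v ∈ words n m → length v ≡ m × All (_∈ pmSet n) v
∈-words⁻ n zero v (here refl) = refl , []
∈-words⁻ n (suc m) v v∈ with ∈-consAll⁻ (pmSet n) (words n m) v∈
... | a , w , a∈ , w∈ , refl with ∈-words⁻ n m w w∈
...   | e , as = cong suc e , (a∈ ∷ as)

consAll≡cartesianProductWith : ∀ P W → consAll P W ≡ cartesianProductWith _∷_ P W
consAll≡cartesianProductWith [] W = refl
consAll≡cartesianProductWith (p ∷ P) W = cong (map (p ∷_) W ++_) (consAll≡cartesianProductWith P W)

pmSet-unique : ∀ n → Unique (pmSet n)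
pmSet-unique n = UP.++⁺ (UP.map⁺ (λ { refl → refl }) (UP.upTo⁺ n)) (UP.map⁺ (λ { refl → refl }) (UP.upTo⁺ n)) disj
  where
  disj : ∀ {v} → ¬ (v ∈ map negSuc (upTo n) × v ∈ map posSuc (upTo n))
  disj (p , q) with ∈-map⁻ negSuc p | ∈-map⁻ posSuc q
  ... | i , _ , refl | j , _ , ()

words-unique : ∀ n m → Unique (words n m)
words-unique n zero = All.[] AllPairs.∷ AllPairs.[]
words-unique n (suc m) = subst Unique (sym (consAll≡cartesianProductWith (pmSet n) (words n m)))
  (UP.cartesianProductWith⁺ _∷_ (λ { refl → refl , refl }) (pmSet-unique n) (words-unique n m))

∈-B⁺ : ∀ {n v} → length v ≡ n → All (_∈ pmSet n) v → Unique (map ∣_∣ v) → v ∈ B n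
∈-B⁺ {n} {v} e as u = ∈-filter⁺ isSignedPerm? (∈-words⁺ n n v e as) u

∈-B⁻ : ∀ {n v} → v ∈ B n → length v ≡ n × All (_∈ pmSet n) v × Unique (map ∣_∣ v)
∈-B⁻ {n} {v} v∈ with ∈-filter⁻ isSignedPerm? v∈
... | w∈ , u with ∈-words⁻ n n v w∈
...   | e , as = e , as , u

B-unique : ∀ n → Unique (B n)
B-unique n = UP.filter⁺ isSignedPerm? (words-unique n n)

sumL : {A : Set} → (A → Poly) → List A → Poly
sumL f [] = []
sumL f (x ∷ xs) = f x ⊕ sumL f xs

sumL-cong : {A : Set} {f g : A → Poly} (xs : List A) → (∀ x → x ∈ xs → f x ≈ g x) → sumL f xs ≈ sumL g xs
sumL-cong [] h = ≈-refl
sumL-cong (x ∷ xs) h = ⊕-cong (h x (here refl)) (sumL-cong xs (λ y y∈ → h y (there y∈)))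

sumL-++ : {A : Set} (f : A → Poly) (xs ys : List A) → sumL f (xs ++ ys) ≈ (sumL f xs ⊕ sumL f ys)
sumL-++ f [] ys = ≈-refl
sumL-++ f (x ∷ xs) ys = ≈-trans (⊕-congˡ (f x) (sumL-++ f xs ys)) (≈-sym (⊕-assoc (f x) (sumL f xs) (sumL f ys)))

sumL-map : {A B : Set} (f : B → Poly) (g : A → B) (xs : List A) → sumL f (map g xs) ≡ sumL (λ x → f (g x)) xs
sumL-map f g [] = refl
sumL-map f g (x ∷ xs) = cong (f (g x) ⊕_) (sumL-map f g xs)

sumL-⊕ : {A : Set} (f g : A → Poly) (xs : List A) → sumL (λ x → f x ⊕ g x) xs ≈ (sumL f xs ⊕ sumL g xs)
sumL-⊕ f g [] = ≈-refl
sumL-⊕ f g (x ∷ xs) = ≈-trans (⊕-congˡ (f x ⊕ g x) (sumL-⊕ f g xs)) (⊕-interchange (f x) (g x) (sumL f xs) (sumL g xs))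

⊗-sumL : {A : Set} (p : Poly) (f : A → Poly) (xs : List A) → (p ⊗ sumL f xs) ≈ sumL (λ x → p ⊗ f x) xs
⊗-sumL p f [] = ⊗-zeroʳ p
⊗-sumL p f (x ∷ xs) = ≈-trans (⊗-distribˡ p (f x) (sumL f xs)) (⊕-congˡ (p ⊗ f x) (⊗-sumL p f xs))

Φ-sumL : {A : Set} (M : ℕ) (f : A → Poly) (xs : List A) → Φ M (sumL f xs) ≈ sumL (λ x → Φ M (f x)) xs
Φ-sumL M f [] = Φ-[] M
Φ-sumL M f (x ∷ xs) = ≈-trans (Φ-⊕ M (f x) (sumL f xs)) (⊕-congˡ (Φ M (f x)) (Φ-sumL M f xs))

sumL-cartesianProduct : {A B : Set} (h : A × B → Poly) (xs : List A) (ys : List B) →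
  sumL h (cartesianProduct xs ys) ≈ sumL (λ x → sumL (λ y → h (x , y)) ys) xs
sumL-cartesianProduct h [] ys = ≈-refl
sumL-cartesianProduct h (x ∷ xs) ys = ≈-trans (sumL-++ h (map (x ,_) ys) (cartesianProduct xs ys))
  (⊕-cong (≡⇒≈ (sumL-map h (x ,_) ys)) (sumL-cartesianProduct h xs ys))

sumL-↭ : {A : Set} (f : A → Poly) {xs ys : List A} → xs ↭ ys → sumL f xs ≈ sumL f ys
sumL-↭ f ↭.refl         = ≈-refl
sumL-↭ f (↭.prep x p)   = ⊕-congˡ (f x) (sumL-↭ f p)
sumL-↭ f (↭.swap x y p) = ≈-trans (⊕-swap (f x) (f y) _) (⊕-congˡ (f y) (⊕-congˡ (f x) (sumL-↭ f p)))
sumL-↭ f (↭.trans p q)  = ≈-trans (sumL-↭ f p) (sumL-↭ f q)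

sumL-sameMembers : {A : Set} (f : A → Poly) {xs ys : List A} → Unique xs → Unique ys →
  (∀ {z} → z ∈ xs → z ∈ ys) → (∀ {z} → z ∈ ys → z ∈ xs) → sumL f xs ≈ sumL f ys
sumL-sameMembers f ux uy to from = sumL-↭ f (∼bag⇒↭ (unique∧set⇒bag ux uy (mk⇔ to from)))

insertAt : {A : Set} → ℕ → A → List A → List A
insertAt zero    t w       = t ∷ w
insertAt (suc p) t []      = t ∷ []
insertAt (suc p) t (a ∷ w) = a ∷ insertAt p t w

length-insertAt : {A : Set} (p : ℕ) (t : A) (w : List A) → length (insertAt p t w) ≡ suc (length w)
length-insertAt zero    t w       = refl
length-insertAt (suc p) t []      = refl
length-insertAt (suc p) t (a ∷ w) = cong suc (length-insertAt p t w)

All-insertAt : {A : Set} {P : A → Set} (p : ℕ) {t : A} {w : List A} → P t → All P w → All P (insertAt p t w)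
All-insertAt zero    pt pw        = pt ∷ pw
All-insertAt (suc p) pt []        = pt ∷ []
All-insertAt (suc p) pt (pa ∷ pw) = pa ∷ All-insertAt p pt pw

map-insertAt : {A B : Set} (f : A → B) (p : ℕ) (t : A) (w : List A) → map f (insertAt p t w) ≡ insertAt p (f t) (map f w)
map-insertAt f zero    t w       = refl
map-insertAt f (suc p) t []      = refl
map-insertAt f (suc p) t (a ∷ w) = cong (f a ∷_) (map-insertAt f p t w)

insertAt-++ : {A : Set} (as : List A) (e : A) (bs : List A) → insertAt (length as) e (as ++ bs) ≡ as ++ e ∷ bs
insertAt-++ []       e bs = refl
insertAt-++ (a ∷ as) e bs = cong (a ∷_) (insertAt-++ as e bs)

insertAt-unique : {A : Set} (p : ℕ) {t : A} {w : List A} → t ∉ w → Unique w → Unique (insertAt p t w)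
insertAt-unique zero t∉ u = AllP.¬Any⇒All¬ _ t∉ AllPairs.∷ u
insertAt-unique (suc p) {w = []} t∉ u = [] AllPairs.∷ AllPairs.[]
insertAt-unique (suc p) {w = a ∷ w} t∉ (pa AllPairs.∷ u) =
  All-insertAt p (λ e → t∉ (here (sym e))) pa AllPairs.∷ insertAt-unique p (λ q → t∉ (there q)) u

insertAt-injective : ∀ {A : Set} {P : A → Set} {p p' e e' w w'} → P e → P e' → All (¬_ ∘ P) w → All (¬_ ∘ P) w' →
  p ≤ length w → p' ≤ length w' → insertAt p e w ≡ insertAt p' e' w' → (p ≡ p') × (e ≡ e') × (w ≡ w')
insertAt-injective {p = zero}  {zero}                     _  _   _          _           _ _ refl = refl , refl , refl
insertAt-injective {p = zero}  {suc p'} {w' = a' ∷ w'}    Pe _   _          (¬Pa' ∷ _)  _ _ refl = ⊥-elim (¬Pa' Pe)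
insertAt-injective {p = suc p} {zero}   {w = a ∷ w}       _  Pe' (¬Pa ∷ _)  _           _ _ refl = ⊥-elim (¬Pa Pe')
insertAt-injective {p = suc p} {suc p'} {w = a ∷ w} {a' ∷ w'} Pe Pe' (_ ∷ ¬Pw) (_ ∷ ¬Pw') (s≤s le) (s≤s le') eq
  with insertAt-injective Pe Pe' ¬Pw ¬Pw' le le' (LP.∷-injectiveʳ eq)
... | refl , refl , refl = refl , refl , cong (_∷ w) (LP.∷-injectiveˡ eq)

module _ {A : Set} where

  ∈-++-∷⁺ : ∀ {z x : A} (as bs : List A) → z ∈ as ++ bs → z ∈ as ++ x ∷ bs
  ∈-++-∷⁺ []       bs p         = there p
  ∈-++-∷⁺ (a ∷ as) bs (here e)  = here e
  ∈-++-∷⁺ (a ∷ as) bs (there p) = there (∈-++-∷⁺ as bs p)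

  All-drop-middle : ∀ {P : A → Set} {x} (as bs : List A) → All P (as ++ x ∷ bs) → All P (as ++ bs)
  All-drop-middle []       bs (_ ∷ ps) = ps
  All-drop-middle (a ∷ as) bs (p ∷ ps) = p ∷ All-drop-middle as bs ps

  unique-drop-middle : ∀ {x : A} (as bs : List A) → Unique (as ++ x ∷ bs) → Unique (as ++ bs)
  unique-drop-middle []       bs (_ AllPairs.∷ u) = u
  unique-drop-middle (a ∷ as) bs (p AllPairs.∷ u) = All-drop-middle as bs p AllPairs.∷ unique-drop-middle as bs u

  unique-middle-∉ : ∀ {x : A} (as bs : List A) → Unique (as ++ x ∷ bs) → x ∉ as ++ bs
  unique-middle-∉ []       bs (p AllPairs.∷ u) x∈          = All.lookup p x∈ refl
  unique-middle-∉ (a ∷ as) bs (p AllPairs.∷ u) (here refl) = All.lookup p (∈-++⁺ʳ as (here refl)) refl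
  unique-middle-∉ (a ∷ as) bs (p AllPairs.∷ u) (there x∈)  = unique-middle-∉ as bs u x∈

  splitAtFirst : (P : A → Set) → (∀ x → Dec (P x)) → (v : List A) →
    (Σ (List A) λ as → Σ A λ e → Σ (List A) λ bs → v ≡ as ++ e ∷ bs × P e) ⊎ All (¬_ ∘ P) v
  splitAtFirst P P? [] = inj₂ []
  splitAtFirst P P? (x ∷ v) with P? x
  ... | yes px = inj₁ ([] , x , v , refl , px)
  ... | no ¬px with splitAtFirst P P? v
  ...   | inj₁ (as , e , bs , refl , pe) = inj₁ (x ∷ as , e , bs , refl , pe)
  ...   | inj₂ none = inj₂ (¬px ∷ none)

  map-unique-injectiveOn : {B : Set} (f : A → B) (xs : List A) → Unique xs →
    (∀ {x y} → x ∈ xs → y ∈ xs → f x ≡ f y → x ≡ y) → Unique (map f xs)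
  map-unique-injectiveOn f [] u inj = AllPairs.[]
  map-unique-injectiveOn f (x ∷ xs) (px AllPairs.∷ u) inj =
    AllP.map⁺ (All.tabulate (λ y∈ e → All.lookup px y∈ (inj (here refl) (there y∈) e)))
    AllPairs.∷ map-unique-injectiveOn f xs u (λ x∈ y∈ e → inj (there x∈) (there y∈) e)

≤-pred-≢ : ∀ {a K} → a ≤ suc K → a ≢ suc K → a ≤ K
≤-pred-≢ a≤ a≢ = ℕP.m<1+n⇒m≤n (ℕP.≤∧≢⇒< a≤ a≢)

unique-bounded-length : ∀ K (ns : List ℕ) → Unique ns → All (_≢ 0) ns → All (_≤ K) ns → length ns ≤ K
unique-bounded-length zero    []       _ _            _            = z≤n
unique-bounded-length zero    (a ∷ ns) _ (a≢0 ∷ _)    (z≤n ∷ _)    = ⊥-elim (a≢0 refl)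
unique-bounded-length (suc K) ns       u ≢0 ≤K with splitAtFirst (_≡ suc K) (ℕP._≟ suc K) ns
... | inj₂ none = ℕP.m≤n⇒m≤1+n (unique-bounded-length K ns u ≢0 (All.zipWith (λ (a≤ , a≢) → ≤-pred-≢ a≤ a≢) (≤K , none)))
... | inj₁ (as , _ , bs , refl , refl) = begin
  length (as ++ suc K ∷ bs)                 ≡⟨ cong length (insertAt-++ as (suc K) bs) ⟨
  length (insertAt (length as) (suc K) (as ++ bs)) ≡⟨ length-insertAt (length as) (suc K) (as ++ bs) ⟩
  suc (length (as ++ bs))                   ≤⟨ s≤s (unique-bounded-length K (as ++ bs) (unique-drop-middle as bs u) (All-drop-middle as bs ≢0) rest≤K) ⟩
  suc K                                     ∎
  where
  open ℕP.≤-Reasoning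
  rest≤K : All (_≤ K) (as ++ bs)
  rest≤K = All.tabulate λ z∈ → ≤-pred-≢ (All.lookup ≤K (∈-++-∷⁺ as bs z∈)) (λ { refl → unique-middle-∉ as bs u z∈ })

-- Signed permutations of ±[M+1] from those of ±[M]

signs : ℕ → List ℤ
signs N = + N ∷ -ᶻ (+ N) ∷ []

signs-abs : ∀ {N e} → e ∈ signs N → ∣ e ∣ ≡ N
signs-abs (here refl) = refl
signs-abs {N} (there (here refl)) = ℤP.∣-i∣≡∣i∣ (+ N)

abs-signs : ∀ {N} e → ∣ e ∣ ≡ N → e ∈ signs N
abs-signs (+ n) refl = here refl
abs-signs {suc n} -[1+ n ] refl = there (here refl)

B-abs-≢-suc : ∀ {M w} → w ∈ B M → All (λ x → ∣ x ∣ ≢ suc M) w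
B-abs-≢-suc {M} w∈ = All.map (λ x∈ e → ℕP.<-irrefl e (s≤s (proj₂ (∈-pmSet⁻ {M} x∈)))) (proj₁ (proj₂ (∈-B⁻ {M} w∈)))

B-suc-has-max : ∀ M {v} → v ∈ B (suc M) → ¬ All (λ x → ∣ x ∣ ≢ suc M) v
B-suc-has-max M {v} v∈ none with ∈-B⁻ {suc M} v∈
... | len , inPm , u = ℕP.1+n≰n (subst (_≤ M) (trans (LP.length-map ∣_∣ v) len)
  (unique-bounded-length M (map ∣_∣ v) u
    (AllP.map⁺ (All.map (λ x∈ ∣x∣≡0 → proj₁ (∈-pmSet⁻ {suc M} x∈) (ℤP.∣i∣≡0⇒i≡0 ∣x∣≡0)) inPm))
    (AllP.map⁺ (All.zipWith (λ (x∈ , ≢) → ≤-pred-≢ (proj₂ (∈-pmSet⁻ {suc M} x∈)) ≢) (inPm , none)))))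

B-suc-remove : ∀ M as e bs → as ++ e ∷ bs ∈ B (suc M) → ∣ e ∣ ≡ suc M → as ++ bs ∈ B M
B-suc-remove M as e bs v∈ ∣e∣ with ∈-B⁻ {suc M} v∈
... | len , inPm , u = ∈-B⁺ {M} lenw (All.tabulate inPm-w) uw
  where
  w = as ++ bs
  lenw : length w ≡ M
  lenw = ℕP.suc-injective (trans (sym (length-insertAt (length as) e w)) (trans (cong length (insertAt-++ as e bs)) len))
  uabs : Unique (map ∣_∣ as ++ ∣ e ∣ ∷ map ∣_∣ bs)
  uabs = subst Unique (LP.map-++ ∣_∣ as (e ∷ bs)) u
  uw : Unique (map ∣_∣ w)
  uw = subst Unique (sym (LP.map-++ ∣_∣ as bs)) (unique-drop-middle (map ∣_∣ as) (map ∣_∣ bs) uabs)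
  ∣e∣∉ : ∣ e ∣ ∉ map ∣_∣ w
  ∣e∣∉ q = unique-middle-∉ (map ∣_∣ as) (map ∣_∣ bs) uabs (subst (∣ e ∣ ∈_) (LP.map-++ ∣_∣ as bs) q)
  inPm-w : ∀ {x} → x ∈ w → x ∈ pmSet M
  inPm-w {x} x∈ with ∈-pmSet⁻ {suc M} (All.lookup inPm (∈-++-∷⁺ as bs x∈))
  ... | x≢0 , ∣x∣≤ = ∈-pmSet⁺ (x≢0 , ≤-pred-≢ ∣x∣≤ (λ eq → ∣e∣∉ (subst (_∈ map ∣_∣ w) (trans eq (sym ∣e∣)) (∈-map⁺ ∣_∣ x∈))))

insertionData : ℕ → List (List ℤ × (ℕ × ℤ))
insertionData M = cartesianProduct (B M) (cartesianProduct (upTo (suc M)) (signs (suc M)))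

insertEntry : List ℤ × (ℕ × ℤ) → List ℤ
insertEntry (w , p , e) = insertAt p e w

insertionData-unique : ∀ M → Unique (insertionData M)
insertionData-unique M = UP.cartesianProduct⁺ (B-unique M) (UP.cartesianProduct⁺ (UP.upTo⁺ (suc M))
  (((λ ()) ∷ []) AllPairs.∷ ([] AllPairs.∷ AllPairs.[])))

B-length-≥ : ∀ M {w p} → w ∈ B M → p < suc M → p ≤ length w
B-length-≥ M {w} w∈ (s≤s p≤) = subst (_ ≤_) (sym (proj₁ (∈-B⁻ {M} w∈))) p≤

insertEntries-unique : ∀ M → Unique (map insertEntry (insertionData M))
insertEntries-unique M = map-unique-injectiveOn insertEntry (insertionData M) (insertionData-unique M) inj
  where
  inj : ∀ {x y} → x ∈ insertionData M → y ∈ insertionData M → insertEntry x ≡ insertEntry y → x ≡ y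
  inj {w , p , e} {w' , p' , e'} x∈ y∈ eq
    with ∈-cartesianProduct⁻ (B M) _ x∈ | ∈-cartesianProduct⁻ (B M) _ y∈
  ... | w∈ , pe∈ | w'∈ , pe'∈
    with ∈-cartesianProduct⁻ (upTo (suc M)) (signs (suc M)) pe∈ | ∈-cartesianProduct⁻ (upTo (suc M)) (signs (suc M)) pe'∈
  ... | p∈ , e∈ | p'∈ , e'∈
    with insertAt-injective {P = λ x → ∣ x ∣ ≡ suc M} (signs-abs e∈) (signs-abs e'∈) (B-abs-≢-suc w∈) (B-abs-≢-suc w'∈)
           (B-length-≥ M w∈ (∈-upTo⁻ p∈)) (B-length-≥ M w'∈ (∈-upTo⁻ p'∈)) eq
  ... | refl , refl , refl = refl

insertEntry-∈-B : ∀ M {v} → v ∈ map insertEntry (insertionData M) → v ∈ B (suc M)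
insertEntry-∈-B M v∈ with ∈-map⁻ insertEntry v∈
... | (w , p , e) , t∈ , refl with ∈-cartesianProduct⁻ (B M) _ t∈
...   | w∈ , pe∈ with ∈-cartesianProduct⁻ (upTo (suc M)) (signs (suc M)) pe∈ | ∈-B⁻ {M} w∈
...     | p∈ , e∈ | len , inPm , u =
  ∈-B⁺ {suc M} (trans (length-insertAt p e w) (cong suc len))
     (All-insertAt p (∈-pmSet⁺ {suc M} e∈pm) (All.map (λ x∈ → ∈-pmSet⁺ {suc M} (InPm-suc (∈-pmSet⁻ {M} x∈))) inPm))
     (subst Unique (sym (map-insertAt ∣_∣ p e w)) (insertAt-unique p ∣e∣∉ u))
  where
  ∣e∣ = signs-abs e∈
  e∈pm : InPm (suc M) e
  e∈pm = (λ { refl → ℕP.0≢1+n ∣e∣ }) , ℕP.≤-reflexive ∣e∣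
  ∣e∣∉ : ∣ e ∣ ∉ map ∣_∣ w
  ∣e∣∉ q with ∈-map⁻ ∣_∣ q
  ... | x , x∈ , eq = All.lookup (B-abs-≢-suc w∈) x∈ (trans (sym eq) ∣e∣)

B-∈-insertEntry : ∀ M {v} → v ∈ B (suc M) → v ∈ map insertEntry (insertionData M)
B-∈-insertEntry M {v} v∈ with splitAtFirst (λ x → ∣ x ∣ ≡ suc M) (λ x → ∣ x ∣ ℕP.≟ suc M) v
... | inj₂ none = ⊥-elim (B-suc-has-max M v∈ none)
... | inj₁ (as , e , bs , refl , ∣e∣) =
  subst (_∈ map insertEntry (insertionData M)) (insertAt-++ as e bs)
    (∈-map⁺ insertEntry (∈-cartesianProduct⁺ w∈ (∈-cartesianProduct⁺ (∈-upTo⁺ (s≤s p≤M)) (abs-signs e ∣e∣))))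
  where
  w∈ = B-suc-remove M as e bs v∈ ∣e∣
  p≤M : length as ≤ M
  p≤M = subst (length as ≤_) (proj₁ (∈-B⁻ {M} w∈)) (LP.length-++-≤ˡ as)

sumL-B-suc : ∀ M (f : List ℤ → Poly) → sumL f (B (suc M)) ≈
  sumL (λ w → sumL (λ p → f (insertAt p (+ suc M) w) ⊕ (f (insertAt p (-ᶻ (+ suc M)) w) ⊕ [])) (upTo (suc M))) (B M)
sumL-B-suc M f = begin
  sumL f (B (suc M))                                    ≈⟨ sumL-sameMembers f (B-unique (suc M)) (insertEntries-unique M) (B-∈-insertEntry M) (insertEntry-∈-B M) ⟩
  sumL f (map insertEntry (insertionData M))            ≡⟨ sumL-map f insertEntry (insertionData M) ⟩
  sumL (f ∘ insertEntry) (insertionData M)              ≈⟨ sumL-cartesianProduct (f ∘ insertEntry) (B M) _ ⟩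
  sumL (λ w → sumL (λ pe → f (insertEntry (w , pe))) (cartesianProduct (upTo (suc M)) (signs (suc M)))) (B M)
    ≈⟨ sumL-cong (B M) (λ w _ → sumL-cartesianProduct (λ pe → f (insertEntry (w , pe))) (upTo (suc M)) (signs (suc M))) ⟩
  sumL (λ w → sumL (λ p → f (insertAt p (+ suc M) w) ⊕ (f (insertAt p (-ᶻ (+ suc M)) w) ⊕ [])) (upTo (suc M))) (B M) ∎
  where open ≈-Reasoning

-- Words of ascents and descents

normalize : Poly → Poly
normalize [] = []
normalize (a ∷ p) with normalize p
... | b ∷ q = a ∷ b ∷ q
... | [] with a ℤP.≟ + 0
...   | yes _ = []
...   | no _ = a ∷ []

coeff-normalize : ∀ p k → coeff (normalize p) k ≡ coeff p k
coeff-normalize [] k = refl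
coeff-normalize (a ∷ p) k with normalize p | coeff-normalize p
... | b ∷ q | ih = lemma k
  where
  lemma : ∀ k → coeff (a ∷ b ∷ q) k ≡ coeff (a ∷ p) k
  lemma zero    = refl
  lemma (suc k) = ih k
... | [] | ih with a ℤP.≟ + 0
...   | yes refl = lemma k
  where
  lemma : ∀ k → + 0 ≡ coeff (+ 0 ∷ p) k
  lemma zero    = refl
  lemma (suc k) = ih k
...   | no _ = lemma k
  where
  lemma : ∀ k → coeff (a ∷ []) k ≡ coeff (a ∷ p) k
  lemma zero    = refl
  lemma (suc k) = ih k

≈-by-normalize : ∀ p q → normalize p ≡ normalize q → p ≈ q
≈-by-normalize p q e = coeffwise λ k → trans (sym (coeff-normalize p k)) (trans (cong (λ r → coeff r k) e) (coeff-normalize q k))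

sumL-upTo-suc : ∀ n (f : ℕ → Poly) → sumL f (upTo (suc n)) ≡ (f 0 ⊕ sumL (f ∘ suc) (upTo n))
sumL-upTo-suc n f = cong (f 0 ⊕_) (trans (cong (sumL f) (sym (LP.map-upTo suc n))) (sumL-map f suc (upTo n)))

^^-+ : ∀ p a b → (p ^^ (a + b)) ≈ ((p ^^ a) ⊗ (p ^^ b))
^^-+ p zero    b = ≈-sym (⊗-identityˡ (p ^^ b))
^^-+ p (suc a) b = ≈-trans (⊗-congˡ p (^^-+ p a b)) (≈-sym (⊗-assoc p (p ^^ a) (p ^^ b)))

changeBit : Bool → Bool → ℕ
changeBit x y = if x xor y then 1 else 0

changes : List Bool → ℕ
changes (x ∷ y ∷ l) = changeBit x y + changes (y ∷ l)
changes _ = 0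

-- Directions (true = ascent) after inserting a new largest entry at position p:
-- the direction at p is replaced by an ascent followed by a descent.
insertPeakDirs : ℕ → List Bool → List Bool
insertPeakDirs zero    []      = true ∷ []
insertPeakDirs zero    (b ∷ d) = true ∷ false ∷ d
insertPeakDirs (suc p) []      = true ∷ []
insertPeakDirs (suc p) (b ∷ d) = b ∷ insertPeakDirs p d

peakInsertions : List Bool → Poly
peakInsertions d = sumL (λ p → X ^^ changes (insertPeakDirs p d)) (upTo (suc (length d)))

peakInsertionsAfter : Bool → List Bool → Poly
peakInsertionsAfter a d = sumL (λ p → X ^^ changes (a ∷ insertPeakDirs p d)) (upTo (suc (length d)))

quadratic : ℤ → ℤ → ℤ → Poly
quadratic α γ β = (const α ⊕ (const γ ⊗ X)) ⊕ (const β ⊗ (X ⊗ X))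

bothUp : Bool → List Bool → ℕ
bothUp a []      = 0
bothUp a (b ∷ _) = if a ∧ b then 1 else 0

-- Of the length d + 1 insertion positions, α leave the number of changes unchanged,
-- one adds one change and the remaining ones add two.
peakInsertionsAfterClosed : Bool → List Bool → Poly
peakInsertionsAfterClosed a d = (X ^^ changes (a ∷ d)) ⊗ quadratic α (+ 1) (+ length d +ᶻ -ᶻ α)
  where α = + (bothUp a d + changes (a ∷ d))

peakInsertionsAfter-∷ : ∀ a b d → peakInsertionsAfter a (b ∷ d) ≈
  ((X ^^ changes (a ∷ true ∷ false ∷ d)) ⊕ ((X ^^ changeBit a b) ⊗ peakInsertionsAfter b d))
peakInsertionsAfter-∷ a b d =
  ≈-trans (≡⇒≈ (sumL-upTo-suc (suc (length d)) (λ p → X ^^ changes (a ∷ insertPeakDirs p (b ∷ d)))))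
  (⊕-congˡ (X ^^ changes (a ∷ true ∷ false ∷ d))
   (≈-trans (sumL-cong (upTo (suc (length d))) (λ p _ → ^^-+ X (changeBit a b) (changes (b ∷ insertPeakDirs p d))))
            (≈-sym (⊗-sumL (X ^^ changeBit a b) (λ p → X ^^ changes (b ∷ insertPeakDirs p d)) (upTo (suc (length d)))))))

-- absorbᵢ: adding x^(c+i) to x^c times a quadratic raises its coefficient of x^i by one.
absorb₀ : ∀ ℓ c α → ((X ^^ c) ⊕ ((X ^^ c) ⊗ quadratic α (+ 1) (+ ℓ +ᶻ -ᶻ α)))
                     ≈ ((X ^^ c) ⊗ quadratic (+ 1 +ᶻ α) (+ 1) (+ suc ℓ +ᶻ -ᶻ (+ 1 +ᶻ α)))
absorb₀ ℓ c α = solve 4 (λ x Z A L → Z :+ (Z :* ((A :+ (con (+ 1) :* x)) :+ ((L :+ (:- A)) :* (x :* x))))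
   := Z :* (((con (+ 1) :+ A) :+ (con (+ 1) :* x)) :+ (((con (+ 1) :+ L) :+ (:- (con (+ 1) :+ A))) :* (x :* x)))) ≈-refl X (X ^^ c) (const α) (const (+ ℓ))
absorb₂ : ∀ ℓ c α → ((X ^^ suc (suc c)) ⊕ ((X ^^ c) ⊗ quadratic α (+ 1) (+ ℓ +ᶻ -ᶻ α)))
                   ≈ ((X ^^ c) ⊗ quadratic α (+ 1) (+ suc ℓ +ᶻ -ᶻ α))
absorb₂ ℓ c α = solve 4 (λ x Z A L → (x :* (x :* Z)) :+ (Z :* ((A :+ (con (+ 1) :* x)) :+ ((L :+ (:- A)) :* (x :* x))))
   := Z :* ((A :+ (con (+ 1) :* x)) :+ (((con (+ 1) :+ L) :+ (:- A)) :* (x :* x)))) ≈-refl X (X ^^ c) (const α) (const (+ ℓ))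

absorb₂′ : ∀ ℓ c → ((X ^^ suc (suc c)) ⊕ ((X ^^ c) ⊗ quadratic (+ (1 + c)) (+ 1) (+ ℓ +ᶻ -ᶻ (+ (1 + c)))))
                 ≈ ((X ^^ c) ⊗ quadratic (+ (1 + c)) (+ 1) (+ ℓ +ᶻ -ᶻ (+ c)))
absorb₂′ ℓ c = solve 4 (λ x Z C L → (x :* (x :* Z)) :+ (Z :* (((con (+ 1) :+ C) :+ (con (+ 1) :* x)) :+ ((L :+ (:- (con (+ 1) :+ C))) :* (x :* x))))
   := Z :* (((con (+ 1) :+ C) :+ (con (+ 1) :* x)) :+ ((L :+ (:- C)) :* (x :* x)))) ≈-refl X (X ^^ c) (const (+ c)) (const (+ ℓ))
absorb₀′ : ∀ ℓ c → ((X ^^ c) ⊕ ((X ^^ c) ⊗ quadratic (+ c) (+ 1) (+ ℓ +ᶻ -ᶻ (+ c))))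
                   ≈ ((X ^^ c) ⊗ quadratic (+ (1 + c)) (+ 1) (+ ℓ +ᶻ -ᶻ (+ c)))
absorb₀′ ℓ c = solve 4 (λ x Z C L → Z :+ (Z :* ((C :+ (con (+ 1) :* x)) :+ ((L :+ (:- C)) :* (x :* x))))
   := Z :* (((con (+ 1) :+ C) :+ (con (+ 1) :* x)) :+ ((L :+ (:- C)) :* (x :* x)))) ≈-refl X (X ^^ c) (const (+ c)) (const (+ ℓ))
absorb₁′ : ∀ ℓ c → ((X ^^ suc c) ⊕ ((X ^^ c) ⊗ quadratic (+ c) (+ 1) (+ ℓ +ᶻ -ᶻ (+ c))))
                 ≈ ((X ^^ c) ⊗ quadratic (+ c) (+ 2) (+ ℓ +ᶻ -ᶻ (+ c)))
absorb₁′ ℓ c = solve 4 (λ x Z C L → (x :* Z) :+ (Z :* ((C :+ (con (+ 1) :* x)) :+ ((L :+ (:- C)) :* (x :* x))))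
   := Z :* ((C :+ (con (+ 2) :* x)) :+ ((L :+ (:- C)) :* (x :* x)))) ≈-refl X (X ^^ c) (const (+ c)) (const (+ ℓ))

peakInsertionsAfter-step : ∀ a b b' d →
  ((X ^^ changes (a ∷ true ∷ false ∷ b' ∷ d)) ⊕ ((X ^^ changes (a ∷ b ∷ b' ∷ d)) ⊗ quadratic (+ (bothUp b (b' ∷ d) + changes (b ∷ b' ∷ d))) (+ 1) (+ length (b' ∷ d) +ᶻ -ᶻ (+ (bothUp b (b' ∷ d) + changes (b ∷ b' ∷ d))))))
  ≈ peakInsertionsAfterClosed a (b ∷ b' ∷ d)
peakInsertionsAfter-step a b b' d with a | b | b'
... | true  | true  | true  = absorb₂ (suc (length d)) (changes (true ∷ d)) (+ (1 + changes (true ∷ d)))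
... | true  | true  | false = absorb₀ (suc (length d)) (suc (changes (false ∷ d))) (+ suc (changes (false ∷ d)))
... | true  | false | true  = absorb₀ (suc (length d)) (suc (suc (changes (true ∷ d)))) (+ suc (changes (true ∷ d)))
... | true  | false | false = absorb₀ (suc (length d)) (suc (changes (false ∷ d))) (+ (changes (false ∷ d)))
... | false | true  | true  = absorb₂ (suc (length d)) (suc (changes (true ∷ d))) (+ suc (changes (true ∷ d)))
... | false | true  | false = absorb₀ (suc (length d)) (suc (suc (changes (false ∷ d)))) (+ suc (changes (false ∷ d)))
... | false | false | true  = absorb₂ (suc (length d)) (suc (changes (true ∷ d))) (+ suc (changes (true ∷ d)))
... | false | false | false = absorb₂ (suc (length d)) (changes (false ∷ d)) (+ (changes (false ∷ d)))

peakInsertionsAfter≈closed : ∀ a b d → peakInsertionsAfter a (b ∷ d) ≈ peakInsertionsAfterClosed a (b ∷ d)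
peakInsertionsAfter≈closed true  true  [] = ≈-by-normalize _ _ refl
peakInsertionsAfter≈closed true  false [] = ≈-by-normalize _ _ refl
peakInsertionsAfter≈closed false true  [] = ≈-by-normalize _ _ refl
peakInsertionsAfter≈closed false false [] = ≈-by-normalize _ _ refl
peakInsertionsAfter≈closed a b (b' ∷ d) = begin
  peakInsertionsAfter a (b ∷ b' ∷ d)                                  ≈⟨ peakInsertionsAfter-∷ a b (b' ∷ d) ⟩
  first ⊕ ((X ^^ changeBit a b) ⊗ peakInsertionsAfter b (b' ∷ d))      ≈⟨ ⊕-congˡ first (⊗-congˡ (X ^^ changeBit a b) (peakInsertionsAfter≈closed b b' d)) ⟩
  first ⊕ ((X ^^ changeBit a b) ⊗ ((X ^^ c) ⊗ q))                      ≈⟨ ⊕-congˡ first (≈-sym (⊗-assoc (X ^^ changeBit a b) (X ^^ c) q)) ⟩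
  first ⊕ (((X ^^ changeBit a b) ⊗ (X ^^ c)) ⊗ q)                      ≈⟨ ⊕-congˡ first (⊗-congʳ q (≈-sym (^^-+ X (changeBit a b) c))) ⟩
  first ⊕ ((X ^^ (changeBit a b + c)) ⊗ q)                             ≈⟨ peakInsertionsAfter-step a b b' d ⟩
  peakInsertionsAfterClosed a (b ∷ b' ∷ d)                            ∎
  where
  open ≈-Reasoning
  first = X ^^ changes (a ∷ true ∷ false ∷ b' ∷ d)
  c = changes (b ∷ b' ∷ d)
  α = + (bothUp b (b' ∷ d) + c)
  q = quadratic α (+ 1) (+ length (b' ∷ d) +ᶻ -ᶻ α)

upBit downBit : Bool → ℕ
upBit true    = 1
upBit false   = 0
downBit true  = 0
downBit false = 1

peakInsertionsClosed : Bool → List Bool → Poly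
peakInsertionsClosed b d =
  (X ^^ changes (b ∷ d)) ⊗ quadratic (+ (upBit b + changes (b ∷ d))) (+ (1 + downBit b)) (+ length d +ᶻ -ᶻ (+ changes (b ∷ d)))

peakInsertions-∷ : ∀ b d → peakInsertions (b ∷ d) ≡ ((X ^^ changes (true ∷ false ∷ d)) ⊕ peakInsertionsAfter b d)
peakInsertions-∷ b d = sumL-upTo-suc (suc (length d)) (λ p → X ^^ changes (insertPeakDirs p (b ∷ d)))

peakInsertions-step : ∀ b b' d →
  ((X ^^ changes (true ∷ false ∷ b' ∷ d)) ⊕ peakInsertionsAfterClosed b (b' ∷ d)) ≈ peakInsertionsClosed b (b' ∷ d)
peakInsertions-step b b' d with b | b'
... | true  | true  = absorb₂′ (suc (length d)) (changes (true ∷ d))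
... | true  | false = absorb₀′ (suc (length d)) (suc (changes (false ∷ d)))
... | false | true  = absorb₁′ (suc (length d)) (suc (changes (true ∷ d)))
... | false | false = absorb₁′ (suc (length d)) (changes (false ∷ d))

peakInsertions≈closed : ∀ b d → peakInsertions (b ∷ d) ≈ peakInsertionsClosed b d
peakInsertions≈closed true  [] = ≈-by-normalize _ _ refl
peakInsertions≈closed false [] = ≈-by-normalize _ _ refl
peakInsertions≈closed b (b' ∷ d) rewrite peakInsertions-∷ b (b' ∷ d) =
  ≈-trans (⊕-congˡ (X ^^ changes (true ∷ false ∷ b' ∷ d)) (peakInsertionsAfter≈closed b b' d)) (peakInsertions-step b b' d)

directions : List ℤ → List Bool
directions (a ∷ b ∷ l) = ⌊ a <? b ⌋ ∷ directions (b ∷ l)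
directions _ = []

turns≡changes : ∀ l → turns l ≡ changes (directions l)
turns≡changes [] = refl
turns≡changes (a ∷ []) = refl
turns≡changes (a ∷ b ∷ []) = refl
turns≡changes (a ∷ b ∷ c ∷ l) = cong (_+_ _) (turns≡changes (b ∷ c ∷ l))

length-directions : ∀ a w → length (directions (a ∷ w)) ≡ length w
length-directions a [] = refl
length-directions a (b ∷ w) = cong suc (length-directions b w)

<?-true : ∀ {a b} → a <ᶻ b → ⌊ a <? b ⌋ ≡ true
<?-true {a} {b} a<b with a <? b
... | yes _ = refl
... | no ¬p = ⊥-elim (¬p a<b)

<?-false : ∀ {a b} → b <ᶻ a → ⌊ a <? b ⌋ ≡ false
<?-false {a} {b} b<a with a <? b
... | yes a<b = ⊥-elim (ℤP.<-asym a<b b<a)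
... | no _ = refl

directions-insertAt : ∀ p {a t} w → a <ᶻ t → All (_<ᶻ t) w → directions (a ∷ insertAt p t w) ≡ insertPeakDirs p (directions (a ∷ w))
directions-insertAt zero [] a<t al = cong (_∷ []) (<?-true a<t)
directions-insertAt zero (b ∷ w) a<t (b<t ∷ al) = cong₂ _∷_ (<?-true a<t) (cong (_∷ directions (b ∷ w)) (<?-false b<t))
directions-insertAt (suc p) [] a<t al = cong (_∷ []) (<?-true a<t)
directions-insertAt (suc p) (b ∷ w) a<t (b<t ∷ al) = cong (_ ∷_) (directions-insertAt p w b<t al)

negateWord : List ℤ → List ℤ
negateWord = map -ᶻ_

negateWord-involutive : ∀ w → negateWord (negateWord w) ≡ w
negateWord-involutive [] = refl
negateWord-involutive (a ∷ w) = cong₂ _∷_ (ℤP.neg-involutive a) (negateWord-involutive w)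

<?-negate : ∀ {a b} → a ≢ b → ⌊ -ᶻ a <? -ᶻ b ⌋ ≡ not ⌊ a <? b ⌋
<?-negate {a} {b} a≢b with a <? b
... | yes a<b = <?-false (ℤP.neg-mono-< a<b)
... | no a≮b with ℤP.<-cmp a b
...   | tri< a<b _ _ = ⊥-elim (a≮b a<b)
...   | tri≈ _ e _ = ⊥-elim (a≢b e)
...   | tri> _ _ b<a = <?-true (ℤP.neg-mono-< b<a)

AdjacentDistinct : List ℤ → Set
AdjacentDistinct (a ∷ b ∷ l) = (a ≢ b) × AdjacentDistinct (b ∷ l)
AdjacentDistinct _ = ⊤

directions-negateWord : ∀ l → AdjacentDistinct l → directions (negateWord l) ≡ map not (directions l)
directions-negateWord [] _ = refl
directions-negateWord (a ∷ []) _ = refl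
directions-negateWord (a ∷ b ∷ l) (a≢b , ad) = cong₂ _∷_ (<?-negate a≢b) (directions-negateWord (b ∷ l) ad)

changeBit-not : ∀ x y → changeBit (not x) (not y) ≡ changeBit x y
changeBit-not true  true  = refl
changeBit-not true  false = refl
changeBit-not false true  = refl
changeBit-not false false = refl

changes-map-not : ∀ d → changes (map not d) ≡ changes d
changes-map-not [] = refl
changes-map-not (x ∷ []) = refl
changes-map-not (x ∷ y ∷ d) = cong₂ _+_ (changeBit-not x y) (changes-map-not (y ∷ d))

altRuns-negateWord : ∀ v → AdjacentDistinct (+ 0 ∷ v) → altRuns (negateWord v) ≡ altRuns v
altRuns-negateWord v ad = cong suc (trans (turns≡changes (+ 0 ∷ negateWord v))
  (trans (cong changes (directions-negateWord (+ 0 ∷ v) ad)) (trans (changes-map-not (directions (+ 0 ∷ v))) (sym (turns≡changes (+ 0 ∷ v))))))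

isUp-negateWord : ∀ v → AdjacentDistinct (+ 0 ∷ v) → v ≢ [] → isUp (negateWord v) ≡ not (isUp v)
isUp-negateWord [] _ ne = ⊥-elim (ne refl)
isUp-negateWord (a ∷ v) (0≢a , _) _ = <?-negate 0≢a

adjacentDistinct : ∀ a v → ∣ a ∣ ∉ map ∣_∣ v → All (λ x → x ≢ + 0) v → Unique (map ∣_∣ v) → AdjacentDistinct (a ∷ v)
adjacentDistinct a [] _ _ _ = tt
adjacentDistinct a (b ∷ v) a∉ (nz ∷ nzs) (pb AllPairs.∷ u) = (λ { refl → a∉ (here refl) }) , adjacentDistinct b v (λ q → All.lookup pb q refl) nzs u

B-adjacentDistinct : ∀ K {v} → v ∈ B K → AdjacentDistinct (+ 0 ∷ v)
B-adjacentDistinct K {v} v∈ with ∈-B⁻ {K} v∈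
... | _ , as , u = adjacentDistinct (+ 0) v notin (All.map (λ x∈ → proj₁ (∈-pmSet⁻ {K} x∈)) as) u
  where
  notin : 0 ∉ map ∣_∣ v
  notin q with ∈-map⁻ ∣_∣ q
  ... | x , x∈ , e = proj₁ (∈-pmSet⁻ {K} (All.lookup as x∈)) (ℤP.∣i∣≡0⇒i≡0 (sym e))

map-abs-negateWord : ∀ w → map ∣_∣ (negateWord w) ≡ map ∣_∣ w
map-abs-negateWord [] = refl
map-abs-negateWord (a ∷ w) = cong₂ _∷_ (ℤP.∣-i∣≡∣i∣ a) (map-abs-negateWord w)

B-negateWord : ∀ K {w} → w ∈ B K → negateWord w ∈ B K
B-negateWord K {w} w∈ with ∈-B⁻ {K} w∈
... | len , as , u = ∈-B⁺ {K} (trans (LP.length-map -ᶻ_ w) len)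
  (AllP.map⁺ (All.map (λ x∈ → ∈-pmSet⁺ {K} (InPm-neg (∈-pmSet⁻ {K} x∈))) as))
  (subst Unique (sym (map-abs-negateWord w)) u)

sumL-B-negate : ∀ K (f : List ℤ → Poly) → sumL f (B K) ≈ sumL (λ w → f (negateWord w)) (B K)
sumL-B-negate K f =
  ≈-trans (sumL-sameMembers f (B-unique K) (UP.map⁺ negateWord-injective (B-unique K)) to from)
          (≡⇒≈ (sumL-map f negateWord (B K)))
  where
  negateWord-injective : ∀ {v w} → negateWord v ≡ negateWord w → v ≡ w
  negateWord-injective {v} {w} e = trans (sym (negateWord-involutive v)) (trans (cong negateWord e) (negateWord-involutive w))
  to : ∀ {w} → w ∈ B K → w ∈ map negateWord (B K)
  to {w} w∈ = subst (_∈ map negateWord (B K)) (negateWord-involutive w) (∈-map⁺ negateWord (B-negateWord K w∈))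
  from : ∀ {w} → w ∈ map negateWord (B K) → w ∈ B K
  from w∈ with ∈-map⁻ negateWord w∈
  ... | w , w∈B , refl = B-negateWord K w∈B

B-entries-< : ∀ M {w} → w ∈ B M → All (_<ᶻ + suc M) w
B-entries-< M {w} w∈ with ∈-B⁻ {M} w∈
... | _ , as , _ = All.map (λ x∈ → below (proj₂ (∈-pmSet⁻ {M} x∈))) as
  where
  below : ∀ {x} → ∣ x ∣ ≤ M → x <ᶻ + suc M
  below {+ n} le = +<+ (s≤s le)
  below { -[1+ n ]} le = -<+

-- The recurrence for R̂

upTerm : Bool → List ℤ → Poly
upTerm true v = X ^^ altRuns v
upTerm false v = []

downTerm : Bool → List ℤ → Poly
downTerm true v = []
downTerm false v = X ^^ altRuns v

upMonomial : List ℤ → Poly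
upMonomial v = upTerm (isUp v) v

upRunsPoly : ℕ → Poly
upRunsPoly K = sumL upMonomial (B K)

upTerm+downTerm : ∀ b v → (upTerm b v ⊕ downTerm b v) ≈ (X ^^ altRuns v)
upTerm+downTerm true v = ⊕-identityʳ _
upTerm+downTerm false v = ≈-refl

upMonomial-negateWord : ∀ K v → v ∈ B K → v ≢ [] → upMonomial (negateWord v) ≈ downTerm (isUp v) v
upMonomial-negateWord K v v∈ ne = ≈-trans (≡⇒≈ (cong (λ b → upTerm b (negateWord v)) (isUp-negateWord v (B-adjacentDistinct K v∈) ne))) (byUpness (isUp v))
  where
  byUpness : ∀ b → upTerm (not b) (negateWord v) ≈ downTerm b v
  byUpness true = ≈-refl
  byUpness false = ≡⇒≈ (cong (X ^^_) (altRuns-negateWord v (B-adjacentDistinct K v∈)))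

insertAt≢[] : ∀ p (t : ℤ) w → insertAt p t w ≢ []
insertAt≢[] zero t w ()
insertAt≢[] (suc p) t [] ()
insertAt≢[] (suc p) t (a ∷ w) ()

insertAt-negate : ∀ p t w → insertAt p (-ᶻ t) (negateWord w) ≡ negateWord (insertAt p t w)
insertAt-negate p t w = sym (map-insertAt -ᶻ_ p t w)

insertAt-∈-B : ∀ M {w p} → w ∈ B M → p ∈ upTo (suc M) → insertAt p (+ suc M) w ∈ B (suc M)
insertAt-∈-B M w∈ p∈ = insertEntry-∈-B M (∈-map⁺ insertEntry (∈-cartesianProduct⁺ w∈ (∈-cartesianProduct⁺ p∈ (here refl))))

peakInsertionsPoly : ℕ → List ℤ → Poly
peakInsertionsPoly M w = sumL (λ p → X ^^ altRuns (insertAt p (+ suc M) w)) (upTo (suc M))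

-- Inserting −(M+1) into w is negating the insertion of M+1 into −w, which turns an up
-- permutation into a down one with the same runs; so each insertion of M+1 is counted once.
upRunsPoly-suc : ∀ M → upRunsPoly (suc M) ≈ sumL (peakInsertionsPoly M) (B M)
upRunsPoly-suc M = begin
  sumL upMonomial (B (suc M))                                 ≈⟨ sumL-B-suc M upMonomial ⟩
  sumL (λ w → sumL (λ p → plus w p ⊕ (minus w p ⊕ [])) P) (B M)
    ≈⟨ sumL-cong (B M) (λ w _ → ≈-trans (sumL-cong P (λ p _ → ⊕-congˡ (plus w p) (⊕-identityʳ (minus w p))))
                                         (sumL-⊕ (plus w) (minus w) P)) ⟩
  sumL (λ w → Σplus w ⊕ Σminus w) (B M)                       ≈⟨ sumL-⊕ Σplus Σminus (B M) ⟩
  sumL Σplus (B M) ⊕ sumL Σminus (B M)                        ≈⟨ ⊕-congˡ (sumL Σplus (B M)) (sumL-B-negate M Σminus) ⟩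
  sumL Σplus (B M) ⊕ sumL (Σminus ∘ negateWord) (B M)
    ≈⟨ ⊕-congˡ (sumL Σplus (B M)) (sumL-cong (B M) (λ w w∈ → sumL-cong P (minus-negate w∈))) ⟩
  sumL Σplus (B M) ⊕ sumL (λ w → sumL (plusDown w) P) (B M)   ≈⟨ sumL-⊕ Σplus (λ w → sumL (plusDown w) P) (B M) ⟨
  sumL (λ w → Σplus w ⊕ sumL (plusDown w) P) (B M)
    ≈⟨ sumL-cong (B M) (λ w _ → ≈-trans (≈-sym (sumL-⊕ (plus w) (plusDown w) P))
         (sumL-cong P (λ p _ → upTerm+downTerm (isUp (insertAt p N w)) (insertAt p N w)))) ⟩
  sumL (peakInsertionsPoly M) (B M)                           ∎
  where
  open ≈-Reasoning
  N = + suc M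
  P = upTo (suc M)
  plus minus plusDown : List ℤ → ℕ → Poly
  plus     w p = upMonomial (insertAt p N w)
  minus    w p = upMonomial (insertAt p (-ᶻ N) w)
  plusDown w p = downTerm (isUp (insertAt p N w)) (insertAt p N w)
  Σplus Σminus : List ℤ → Poly
  Σplus  w = sumL (plus w) P
  Σminus w = sumL (minus w) P
  minus-negate : ∀ {w} → w ∈ B M → ∀ p → p ∈ P → minus (negateWord w) p ≈ plusDown w p
  minus-negate {w} w∈ p p∈ = ≈-trans (≡⇒≈ (cong upMonomial (insertAt-negate p N w)))
    (upMonomial-negateWord (suc M) (insertAt p N w) (insertAt-∈-B M w∈ p∈) (insertAt≢[] p N w))

peakInsertionsPoly≈closed : ∀ M' w → w ∈ B (suc M') → peakInsertionsPoly (suc M') w ≈ (X ⊗ peakInsertionsClosed (isUp w) (directions w))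
peakInsertionsPoly≈closed M' [] w∈ with proj₁ (∈-B⁻ {suc M'} w∈)
... | ()
peakInsertionsPoly≈closed M' (a ∷ w') w∈ = begin
  peakInsertionsPoly M (a ∷ w') ≈⟨ sumL-cong (upTo (suc M)) (λ p _ → ⊗-congˡ X (≡⇒≈ (cong (X ^^_) (trans (turns≡changes (+ 0 ∷ insertAt p N (a ∷ w'))) (cong changes (directions-insertAt p (a ∷ w') (+<+ (s≤s z≤n)) (B-entries-< M w∈))))))) ⟩
  sumL (λ p → X ⊗ (X ^^ changes (insertPeakDirs p d))) (upTo (suc M)) ≈⟨ ≈-sym (⊗-sumL X (λ p → X ^^ changes (insertPeakDirs p d)) (upTo (suc M))) ⟩
  X ⊗ sumL (λ p → X ^^ changes (insertPeakDirs p d)) (upTo (suc M)) ≈⟨ ⊗-congˡ X (≡⇒≈ (cong (λ n → sumL (λ p → X ^^ changes (insertPeakDirs p d)) (upTo (suc n))) (sym lenEq))) ⟩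
  X ⊗ peakInsertions d ≈⟨ ⊗-congˡ X (peakInsertions≈closed (isUp (a ∷ w')) (directions (a ∷ w'))) ⟩
  X ⊗ peakInsertionsClosed (isUp (a ∷ w')) (directions (a ∷ w')) ∎
  where
  open ≈-Reasoning
  M = suc M'
  N = + suc M
  d = directions (+ 0 ∷ a ∷ w')
  lenEq : length d ≡ M
  lenEq = trans (length-directions (+ 0) (a ∷ w')) (proj₁ (∈-B⁻ {M} w∈))

upClosed : Bool → List ℤ → Poly
upClosed true w = X ⊗ peakInsertionsClosed true (directions w)
upClosed false w = []

downClosed : Bool → List ℤ → Poly
downClosed true w = []
downClosed false w = X ⊗ peakInsertionsClosed false (directions w)

closed-split : ∀ b w → (X ⊗ peakInsertionsClosed b (directions w)) ≈ (upClosed b w ⊕ downClosed b w)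
closed-split true w = ≈-sym (⊕-identityʳ _)
closed-split false w = ≈-refl

peakInsertionsClosed-negate : ∀ d' → ((X ^^ changes (false ∷ map not d')) ⊗ quadratic (+ (0 + changes (false ∷ map not d'))) (+ (1 + 1)) (+ length (map not d') +ᶻ -ᶻ (+ changes (false ∷ map not d'))))
  ≡ ((X ^^ changes (true ∷ d')) ⊗ quadratic (+ changes (true ∷ d')) (+ 2) (+ length d' +ᶻ -ᶻ (+ changes (true ∷ d'))))
peakInsertionsClosed-negate d' rewrite changes-map-not (true ∷ d') | LP.length-map not d' = refl

closed-pair-identity : ∀ c ℓ → ((X ⊗ ((X ^^ c) ⊗ quadratic (+ (1 + c)) (+ 1) (+ ℓ +ᶻ -ᶻ (+ c)))) ⊕ (X ⊗ ((X ^^ c) ⊗ quadratic (+ c) (+ 2) (+ ℓ +ᶻ -ᶻ (+ c)))))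
  ≈ (((const (+ 2) ⊗ (const (+ suc c) ⊗ (1+x ⊗ 1-x))) ⊕ linearPart (suc ℓ)) ⊗ (X ^^ suc c))
closed-pair-identity c ℓ = ≈-trans
  (solve 4 (λ x Z C L → (x :* (Z :* (((con (+ 1) :+ C) :+ (con (+ 1) :* x)) :+ ((L :+ (:- C)) :* (x :* x))))) :+ (x :* (Z :* ((C :+ (con (+ 2) :* x)) :+ ((L :+ (:- C)) :* (x :* x)))))
     := ((con (+ 2) :* ((con (+ 1) :+ C) :* ((con (+ 1) :+ x) :* (con (+ 1) :- x)))) :+ ((con -[1+ 0 ] :+ (con (+ 3) :* x)) :+ ((con (+ 2) :+ (con (+ 2) :* L)) :* (x :* x)))) :* (x :* Z)) ≈-refl X (X ^^ c) (const (+ c)) (const (+ ℓ)))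
  (⊗-congʳ (X ^^ suc c) (⊕-congˡ (const (+ 2) ⊗ (const (+ suc c) ⊗ (1+x ⊗ 1-x))) (⊕-congˡ (const -[1+ 0 ] ⊕ (const (+ 3) ⊗ X)) (⊗-congʳ (X ⊗ X) 2+2ℓ≈))))
  where
  2+2ℓ≈ : (const (+ 2) ⊕ (const (+ 2) ⊗ const (+ ℓ))) ≈ const (+ (2 * suc ℓ))
  2+2ℓ≈ = ≈-trans (⊕-congˡ (const (+ 2)) (≈-sym (const-ℕ* 2 ℓ))) (const-cong (cong +_ (sym (ℕP.*-suc 2 ℓ))))

closed-pair≈Φ : ∀ M' w → w ∈ B (suc M') → (upClosed (isUp w) w ⊕ downClosed (isUp (negateWord w)) (negateWord w)) ≈ Φ (suc M') (upMonomial w)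
closed-pair≈Φ M' [] w∈ with proj₁ (∈-B⁻ {suc M'} w∈)
... | ()
closed-pair≈Φ M' (a ∷ w') w∈ =
  ≈-trans (≡⇒≈ (cong (λ b → upClosed (isUp w) w ⊕ downClosed b (negateWord w)) (isUp-negateWord w ad (λ ()))))
  (byUpness (isUp w) refl)
  where
  w = a ∷ w'
  ad = B-adjacentDistinct (suc M') w∈
  d' = directions w
  lenEq : length d' ≡ M'
  lenEq = trans (length-directions a w') (ℕP.suc-injective (proj₁ (∈-B⁻ {suc M'} w∈)))
  byUpness : ∀ b → isUp w ≡ b → (upClosed b w ⊕ downClosed (not b) (negateWord w)) ≈ Φ (suc M') (upTerm b w)
  byUpness false eq = ≈-sym (Φ-[] (suc M'))
  byUpness true eq = begin
    (X ⊗ peakInsertionsClosed true d') ⊕ (X ⊗ peakInsertionsClosed false (directions (negateWord w)))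
      ≈⟨ ⊕-congˡ (X ⊗ peakInsertionsClosed true d') (⊗-congˡ X (≡⇒≈ (trans (cong (peakInsertionsClosed false) (directions-negateWord w (proj₂ ad))) (peakInsertionsClosed-negate d')))) ⟩
    (X ⊗ peakInsertionsClosed true d') ⊕ (X ⊗ ((X ^^ c) ⊗ quadratic (+ c) (+ 2) (+ length d' +ᶻ -ᶻ (+ c))))
      ≈⟨ ≡⇒≈ (cong (λ l → (X ⊗ ((X ^^ c) ⊗ quadratic (+ (1 + c)) (+ 1) (+ l +ᶻ -ᶻ (+ c)))) ⊕ (X ⊗ ((X ^^ c) ⊗ quadratic (+ c) (+ 2) (+ l +ᶻ -ᶻ (+ c))))) lenEq) ⟩
    (X ⊗ ((X ^^ c) ⊗ quadratic (+ (1 + c)) (+ 1) (+ M' +ᶻ -ᶻ (+ c)))) ⊕ (X ⊗ ((X ^^ c) ⊗ quadratic (+ c) (+ 2) (+ M' +ᶻ -ᶻ (+ c))))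
      ≈⟨ closed-pair-identity c M' ⟩
    ((const (+ 2) ⊗ (const (+ suc c) ⊗ (1+x ⊗ 1-x))) ⊕ linearPart (suc M')) ⊗ (X ^^ suc c)
      ≈⟨ ≈-sym (Φ-LogDeriv (suc M') (LogDeriv-^^ (suc c) LogDeriv-X)) ⟩
    Φ (suc M') (X ^^ suc c)
      ≈⟨ Φ-cong (suc M') (≡⇒≈ (cong (λ b → X ^^ suc (changes (b ∷ d'))) (sym eq))) ⟩
    Φ (suc M') (X ^^ suc (changes (isUp w ∷ d')))
      ≈⟨ Φ-cong (suc M') (≡⇒≈ (cong (λ n → X ^^ suc n) (sym (turns≡changes (+ 0 ∷ w))))) ⟩
    Φ (suc M') (X ^^ altRuns w) ∎
    where
    open ≈-Reasoning
    c = changes (true ∷ d')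

sumL-closed≈Φ : ∀ M' → sumL (λ w → X ⊗ peakInsertionsClosed (isUp w) (directions w)) (B (suc M')) ≈ Φ (suc M') (upRunsPoly (suc M'))
sumL-closed≈Φ M' = begin
  sumL (λ w → X ⊗ peakInsertionsClosed (isUp w) (directions w)) BM ≈⟨ sumL-cong BM (λ w _ → closed-split (isUp w) w) ⟩
  sumL (λ w → up w ⊕ down w) BM                                  ≈⟨ sumL-⊕ up down BM ⟩
  sumL up BM ⊕ sumL down BM                                      ≈⟨ ⊕-congˡ (sumL up BM) (sumL-B-negate M down) ⟩
  sumL up BM ⊕ sumL (down ∘ negateWord) BM                       ≈⟨ sumL-⊕ up (down ∘ negateWord) BM ⟨
  sumL (λ w → up w ⊕ down (negateWord w)) BM                     ≈⟨ sumL-cong BM (closed-pair≈Φ M') ⟩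
  sumL (λ w → Φ M (upMonomial w)) BM                             ≈⟨ Φ-sumL M upMonomial BM ⟨
  Φ M (upRunsPoly M)                                             ∎
  where
  open ≈-Reasoning
  M = suc M'
  BM = B M
  up down : List ℤ → Poly
  up   w = upClosed (isUp w) w
  down w = downClosed (isUp w) w

upRunsPoly-recurrence : ∀ M' → upRunsPoly (suc (suc M')) ≈ Φ (suc M') (upRunsPoly (suc M'))
upRunsPoly-recurrence M' = begin
  upRunsPoly (suc (suc M'))                                                  ≈⟨ upRunsPoly-suc (suc M') ⟩
  sumL (peakInsertionsPoly (suc M')) (B (suc M'))                            ≈⟨ sumL-cong (B (suc M')) (peakInsertionsPoly≈closed M') ⟩
  sumL (λ w → X ⊗ peakInsertionsClosed (isUp w) (directions w)) (B (suc M')) ≈⟨ sumL-closed≈Φ M' ⟩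
  Φ (suc M') (upRunsPoly (suc M'))                                           ∎
  where open ≈-Reasoning

countL : (List ℤ → Bool) → List (List ℤ) → ℕ
countL p [] = 0
countL p (w ∷ ws) = (if p w then 1 else 0) + countL p ws

-- Rhat counts with a function local to its definition; it is identified with countL through its defining equations.
countL-unique : (p : List ℤ → Bool) (c : List (List ℤ) → ℕ) → c [] ≡ 0 →
  (∀ x xs → c (x ∷ xs) ≡ (if p x then 1 else 0) + c xs) → ∀ xs → c xs ≡ countL p xs
countL-unique p c h0 hs [] = h0
countL-unique p c h0 hs (x ∷ xs) rewrite hs x xs | countL-unique p c h0 hs xs = refl

upWithRuns : ℕ → List ℤ → Bool
upWithRuns k w = isUp w ∧ ⌊ altRuns w ℕP.≟ k ⌋

Rhat≡countL : ∀ n k → Rhat n k ≡ countL (upWithRuns k) (B n)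
Rhat≡countL n k with B n | countL-unique (λ w → isUp w ∧ ⌊ altRuns w ℕP.≟ k ⌋) _ refl (λ x xs → refl)
... | xs | h = h xs

≟-suc : ∀ r k → ⌊ suc r ℕP.≟ suc k ⌋ ≡ ⌊ r ℕP.≟ k ⌋
≟-suc r k with r ℕP.≟ k | suc r ℕP.≟ suc k
... | yes _ | yes _ = refl
... | no _ | no _ = refl
... | yes e | no ne = ⊥-elim (ne (cong suc e))
... | no ne | yes e = ⊥-elim (ne (ℕP.suc-injective e))

δ : ℕ → ℕ → ℕ
δ a b = if ⌊ a ℕP.≟ b ⌋ then 1 else 0

coeff-X^^ : ∀ r k → coeff (X ^^ r) k ≡ + δ r k
coeff-X^^ zero zero = refl
coeff-X^^ zero (suc k) = refl
coeff-X^^ (suc r) zero = coeff-≈ (≈-sym (0∷≈X⊗ (X ^^ r))) zero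
coeff-X^^ (suc r) (suc k) = trans (coeff-≈ (≈-sym (0∷≈X⊗ (X ^^ r))) (suc k)) (trans (coeff-X^^ r k) (cong (λ b → + (if b then 1 else 0)) (sym (≟-suc r k))))

coeff-upTerm : ∀ b w k → coeff (upTerm b w) k ≡ + (if b ∧ ⌊ altRuns w ℕP.≟ k ⌋ then 1 else 0)
coeff-upTerm true w k = coeff-X^^ (altRuns w) k
coeff-upTerm false w k = refl

coeff-sumL-upMonomial : ∀ L k → coeff (sumL upMonomial L) k ≡ + countL (upWithRuns k) L
coeff-sumL-upMonomial [] k = refl
coeff-sumL-upMonomial (w ∷ L) k = trans (coeff-⊕ (upMonomial w) (sumL upMonomial L) k) (cong₂ _+ᶻ_ (coeff-upTerm (isUp w) w k) (coeff-sumL-upMonomial L k))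

coeff-upRunsPoly : ∀ n k → coeff (upRunsPoly n) k ≡ + Rhat n k
coeff-upRunsPoly n k = trans (coeff-sumL-upMonomial (B n) k) (cong +_ (sym (Rhat≡countL n k)))

turns≤ : ∀ a l → turns (a ∷ l) ≤ length l ∸ 1
turns≤ a [] = z≤n
turns≤ a (b ∷ []) = z≤n
turns≤ a (b ∷ c ∷ l) = ℕP.+-mono-≤ (changeBit≤1 ⌊ a <? b ⌋ ⌊ b <? c ⌋) (turns≤ b (c ∷ l))
  where
  changeBit≤1 : ∀ x y → changeBit x y ≤ 1
  changeBit≤1 true  true  = z≤n
  changeBit≤1 true  false = s≤s z≤n
  changeBit≤1 false true  = s≤s z≤n
  changeBit≤1 false false = z≤n

countL-none : ∀ p L → (∀ v → v ∈ L → p v ≡ false) → countL p L ≡ 0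
countL-none p [] h = refl
countL-none p (v ∷ L) h rewrite h v (here refl) = countL-none p L (λ u u∈ → h u (there u∈))

Rhat-0 : ∀ n → Rhat n 0 ≡ 0
Rhat-0 n = trans (Rhat≡countL n 0) (countL-none (upWithRuns 0) (B n) (λ v _ → BoolP.∧-zeroʳ (isUp v)))

altRuns≤length : ∀ v → 1 ≤ length v → altRuns v ≤ length v
altRuns≤length v 1≤ = subst (altRuns v ≤_) (ℕP.m+[n∸m]≡n 1≤) (s≤s (turns≤ (+ 0) v))

Rhat-vanishes : ∀ n k → 1 ≤ n → n < k → Rhat n k ≡ 0
Rhat-vanishes n k 1≤n n<k = trans (Rhat≡countL n k) (countL-none (upWithRuns k) (B n) notCounted)
  where
  notCounted : ∀ v → v ∈ B n → upWithRuns k v ≡ false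
  notCounted v v∈ with altRuns v ℕP.≟ k
  ... | no _ = BoolP.∧-zeroʳ (isUp v)
  ... | yes refl = ⊥-elim (ℕP.<⇒≱ n<k (subst (altRuns v ≤_) len (altRuns≤length v (subst (1 ≤_) (sym len) 1≤n))))
    where
    len = proj₁ (∈-B⁻ {n} v∈)

truncate : ℕ → (ℕ → ℕ) → ℕ → ℕ
truncate h R k = if ⌊ k ℕP.≤? h ⌋ then R k else 0

truncate-≤ : ∀ {h k} R → k ≤ h → truncate h R k ≡ R k
truncate-≤ {h} {k} R le with k ℕP.≤? h
... | yes _ = refl
... | no n = ⊥-elim (n le)

truncate-> : ∀ {h k} R → ¬ (k ≤ h) → truncate h R k ≡ 0
truncate-> {h} {k} R nle with k ℕP.≤? h
... | yes le = ⊥-elim (nle le)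
... | no _ = refl

coeff-const⊗X^^ : ∀ c r k → coeff (const c ⊗ (X ^^ r)) k ≡ c *ᶻ + δ r k
coeff-const⊗X^^ c r k = trans (coeff-≈ (≈-sym (scale≈const⊗ c (X ^^ r))) k) (trans (coeff-scale c (X ^^ r) k) (cong (c *ᶻ_) (coeff-X^^ r k)))

coeff-sumP1 : ∀ (R : ℕ → ℕ) → R 0 ≡ 0 → ∀ h k →
  coeff (sumP 1 h (λ i → const (+ R i) ⊗ (X ^^ i))) k ≡ + truncate h R k
coeff-sumP1 R h0 zero zero = cong +_ (sym h0)
coeff-sumP1 R h0 zero (suc k) = refl
coeff-sumP1 R h0 (suc h) k =
  trans (coeff-⊕ (sumP 1 h F) (F (suc h)) k)
  (trans (cong₂ _+ᶻ_ (coeff-sumP1 R h0 h k) (coeff-const⊗X^^ (+ R (suc h)) (suc h) k)) (cases (k ℕP.≤? h) (suc h ℕP.≟ k)))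
  where
  F = λ i → const (+ R i) ⊗ (X ^^ i)
  cases : Dec (k ≤ h) → Dec (suc h ≡ k) → (+ truncate h R k +ᶻ (+ R (suc h) *ᶻ + δ (suc h) k)) ≡ + truncate (suc h) R k
  cases (yes le) _ with suc h ℕP.≟ k
  ... | yes refl = ⊥-elim (ℕP.<-irrefl refl le)
  ... | no _ = trans (cong₂ (λ a b → + a +ᶻ b) (truncate-≤ R le) (ℤP.*-zeroʳ (+ R (suc h))))
                (trans (ℤP.+-identityʳ _) (cong +_ (sym (truncate-≤ R (ℕP.m≤n⇒m≤1+n le)))))
  cases (no nle) (yes refl) with suc h ℕP.≟ suc h
  ... | yes _ = trans (cong₂ (λ a b → + a +ᶻ b) (truncate-> R nle) (ℤP.*-identityʳ (+ R (suc h))))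
                 (cong +_ (sym (truncate-≤ R ℕP.≤-refl)))
  ... | no ne = ⊥-elim (ne refl)
  cases (no nle) (no ne) with suc h ℕP.≟ k
  ... | yes e = ⊥-elim (ne e)
  ... | no _ = trans (cong₂ (λ a b → + a +ᶻ b) (truncate-> R nle) (ℤP.*-zeroʳ (+ R (suc h))))
                (cong +_ (sym (truncate-> R (λ le → nle (≤-pred-≢ le (ne ∘ sym))))))

RhatPoly≈upRunsPoly : ∀ n → 1 ≤ n → RhatPoly n ≈ upRunsPoly n
RhatPoly≈upRunsPoly n 1≤n = coeffwise λ k → trans (coeff-sumP1 (Rhat n) (Rhat-0 n) n k) (trans (cong +_ (full k (k ℕP.≤? n))) (sym (coeff-upRunsPoly n k)))
  where
  full : ∀ k → Dec (k ≤ n) → truncate n (Rhat n) k ≡ Rhat n k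
  full k (yes le) = truncate-≤ (Rhat n) le
  full k (no nle) = trans (truncate-> (Rhat n) nle) (sym (Rhat-vanishes n k 1≤n (ℕP.≰⇒> nle)))

RhatPoly-recurrence : ∀ n → RhatPoly (suc (suc n)) ≈ Φ (suc n) (RhatPoly (suc n))
RhatPoly-recurrence n = begin
  RhatPoly (suc (suc n))      ≈⟨ RhatPoly≈upRunsPoly (suc (suc n)) (s≤s z≤n) ⟩
  upRunsPoly (suc (suc n))    ≈⟨ upRunsPoly-recurrence n ⟩
  Φ (suc n) (upRunsPoly (suc n)) ≈⟨ Φ-cong (suc n) (RhatPoly≈upRunsPoly (suc n) (s≤s z≤n)) ⟨
  Φ (suc n) (RhatPoly (suc n)) ∎
  where open ≈-Reasoning

RhatPoly-odd : ∀ n → RhatPoly (suc (2 * n)) ≈ rhsPoly n n oddWeight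

RhatPoly-even : ∀ n → RhatPoly (suc (suc (2 * n))) ≈ rhsPoly (suc n) n evenWeight
RhatPoly-even n = begin
  RhatPoly (suc (suc (2 * n)))                  ≈⟨ RhatPoly-recurrence (2 * n) ⟩
  Φ (suc (2 * n)) (RhatPoly (suc (2 * n)))      ≈⟨ Φ-cong (suc (2 * n)) (RhatPoly-odd n) ⟩
  Φ (suc (2 * n)) (rhsPoly n n oddWeight)       ≈⟨ Φ-rhsPoly-even n ⟩
  rhsPoly (suc n) n evenWeight                  ∎
  where open ≈-Reasoning

RhatPoly-odd zero    = ≈-by-normalize _ _ refl
RhatPoly-odd (suc n) = begin
  RhatPoly (suc (2 * suc n))                           ≡⟨ cong (RhatPoly ∘ suc) (ℕP.*-suc 2 n) ⟩
  RhatPoly (suc (suc (suc (2 * n))))                   ≈⟨ RhatPoly-recurrence (suc (2 * n)) ⟩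
  Φ (suc (suc (2 * n))) (RhatPoly (suc (suc (2 * n)))) ≈⟨ Φ-cong (suc (suc (2 * n))) (RhatPoly-even n) ⟩
  Φ (suc (suc (2 * n))) (rhsPoly (suc n) n evenWeight) ≡⟨ cong (λ t → Φ t (rhsPoly (suc n) n evenWeight)) (ℕP.*-suc 2 n) ⟨
  Φ (2 * suc n) (rhsPoly (suc n) n evenWeight)         ≈⟨ Φ-rhsPoly-odd n ⟩
  rhsPoly (suc n) (suc n) oddWeight                    ∎
  where open ≈-Reasoning

corollary5 : (n : ℕ) → n ≥ 1 →
    (RhatPoly (2 * n) ≐ rhsPoly n (n ∸ 1) (λ j → 2 ^ j * (2 * j) !))
    × (RhatPoly (suc (2 * n)) ≐ rhsPoly n n (λ j → 2 ^ j * (suc (2 * j)) !))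
corollary5 (suc n) _ = even , coeff-≈ (RhatPoly-odd (suc n))
  where
  even : RhatPoly (2 * suc n) ≐ rhsPoly (suc n) n evenWeight
  even = subst (λ m → RhatPoly m ≐ rhsPoly (suc n) n evenWeight) (sym (ℕP.*-suc 2 n)) (coeff-≈ (RhatPoly-even n))
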